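{- Let $D(x,q)=\sum_{P} x^{\mathrm{len}(P)}q^{\mathrm{area}(P)}$ over all Dyck paths $P$, and let $s=\sqrt{1-4x^2}$ (branch with $s=1$ at $x=0$). Then $$D(x,1)=\frac{1-s}{2x^2},\qquad \frac{\partial D}{\partial q}(x,1)=\frac{(1-s)^2}{4x^2-16x^4},$$ $$\frac{\partial^3 D}{\partial q^3}(x,1)=\frac{ -6\left(4x^4 s+16x^4-7x^2 s+7x^2-s+1\right)(-1+s)}{(4x^2-1)^4}.$$
   Context: A Dyck path of length $n$ is a walk in the plane from $(0,0)$ to $(n,0)$ using steps $(1,1)$ and $(1,-1)$ that never goes below the $x$-axis; $\mathrm{len}(P)$ is its number of steps and $\mathrm{area}(P)$ the area of the region between the path and the $x$-axis. Derivatives in $q$ at $q=1$ are taken coefficientwise in $x$. -}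

module Defs where

open import Data.Nat as ℕ using (ℕ; zero; suc)
open import Data.Integer as ℤ using (+_)
open import Data.Rational using (ℚ; _+_; _*_; -_; _/_; 0ℚ; 1ℚ)
open import Data.Bool using (Bool; true; false; _∧_)
open import Data.List using (List; []; _∷_; foldr; filter; concatMap; replicate; _++_; length)
open import Relation.Binary.PropositionalEquality using (_≡_)
open import Relation.Nullary using (yes; no)
open import Data.Bool using (T)
open import Data.Bool.Properties using (T?)

data Step : Set where
  U D : Step

words : ℕ → List (List Step)
words zero    = [] ∷ []
words (suc n) = concatMap (λ w → (U ∷ w) ∷ (D ∷ w) ∷ []) (words n)

dyckFrom : ℕ → List Step → Bool
dyckFrom zero    []      = true
dyckFrom (suc _) []      = false
dyckFrom h       (U ∷ w) = dyckFrom (suc h) w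
dyckFrom zero    (D ∷ w) = false
dyckFrom (suc h) (D ∷ w) = dyckFrom h w

isDyck : List Step → Bool
isDyck = dyckFrom 0

dyckPaths : ℕ → List (List Step)
dyckPaths n = filter (λ w → T? (isDyck w)) (words n)

-- area between the path (started at height h) and the x-axis:
-- a step from height a to height b contributes the trapezoid (a+b)/2;
-- we accumulate twice the area, then halve (the total is an integer).
twiceAreaFrom : ℕ → List Step → ℕ
twiceAreaFrom h []      = 0
twiceAreaFrom h (U ∷ w) = h ℕ.+ suc h ℕ.+ twiceAreaFrom (suc h) w
twiceAreaFrom h (D ∷ w) = h ℕ.+ (h ℕ.∸ 1) ℕ.+ twiceAreaFrom (h ℕ.∸ 1) w

area : List Step → ℕ
area w = twiceAreaFrom 0 w ℕ./ 2

-- Polynomials in q with rational coefficients (coefficient of q^i at index i)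

Poly : Set
Poly = List ℚ

infixl 6 _+ₚ_
_+ₚ_ : Poly → Poly → Poly
[]       +ₚ q        = q
p        +ₚ []       = p
(a ∷ p)  +ₚ (b ∷ q)  = (a + b) ∷ (p +ₚ q)

monomial : ℕ → Poly
monomial a = replicate a 0ℚ ++ (1ℚ ∷ [])

derivFrom : ℕ → Poly → Poly
derivFrom i []       = []
derivFrom i (c ∷ cs) = ((+ i / 1) * c) ∷ derivFrom (suc i) cs

deriv : Poly → Poly
deriv []       = []
deriv (_ ∷ cs) = derivFrom 1 cs

derivN : ℕ → Poly → Poly
derivN zero    p = p
derivN (suc k) p = deriv (derivN k p)

eval : ℚ → Poly → ℚ
eval t = foldr (λ c acc → c + t * acc) 0ℚ

-- [x^n] D(x,q) = Σ_{P Dyck, len P = n} q^{area P}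
Dcoeff : ℕ → Poly
Dcoeff n = foldr (λ P acc → monomial (area P) +ₚ acc) [] (dyckPaths n)

FPS : Set
FPS = ℕ → ℚ

infix 4 _≈ₛ_
_≈ₛ_ : FPS → FPS → Set
f ≈ₛ g = ∀ n → f n ≡ g n

infixl 6 _⊕_ _⊖_
infixl 7 _⊗_

_⊕_ : FPS → FPS → FPS
(f ⊕ g) n = f n + g n

⊝_ : FPS → FPS
(⊝ f) n = - f n

_⊖_ : FPS → FPS → FPS
f ⊖ g = f ⊕ (⊝ g)

convUpTo : FPS → FPS → ℕ → ℕ → ℚ
convUpTo f g n zero    = f 0 * g n
convUpTo f g n (suc i) = f (suc i) * g (n ℕ.∸ suc i) + convUpTo f g n i

_⊗_ : FPS → FPS → FPS
(f ⊗ g) n = convUpTo f g n n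

cst : ℚ → FPS
cst c zero    = c
cst c (suc _) = 0ℚ

nat : ℕ → FPS
nat k = cst (+ k / 1)

X^ : ℕ → FPS
X^ m n with m ℕ.≟ n
... | yes _ = 1ℚ
... | no  _ = 0ℚ

infixr 8 _^ₛ_
_^ₛ_ : FPS → ℕ → FPS
f ^ₛ zero  = cst 1ℚ
f ^ₛ suc k = f ⊗ (f ^ₛ k)

-- ∂^k D / ∂q^k (x, 1), taken coefficientwise in x
DqAt1 : ℕ → FPS
DqAt1 k n = eval 1ℚ (derivN k (Dcoeff n))

{-# OPTIONS --safe #-}
-- Cutting a Dyck path at its first return to the axis, P = U P₁ D P₂, gives
-- area P = area P₁ + (len P₁ + 1) + area P₂. Hence the area moments Pₖ = Σ_P area(P)^k x^len(P)
-- satisfy Pₖ = [k = 0] + x² Σ_{α+β+γ=k} (k; α, β, γ) (M^β P_α) P_γ with M = 1 + x d/dx.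
-- For k = 0 this is C = 1 + x²C² (C = P₀), whence s = 1 - 2x²C and (1 + s) C = 2; for k ≥ 1
-- the two terms containing Pₖ combine to (1 - 2x²C) Pₖ = s Pₖ. As s · x ds/dx = s² - 1, the
-- operator x d/dx preserves rational functions of s, so by induction on α + β each M^β P_α is
-- one, with denominator c sᵃ (1 + s)ᵇ. These denominators are units of ℚ[[x]], so such
-- representations can be reduced and compared by polynomial arithmetic in s. Finally the
-- q-derivatives at q = 1 are falling-factorial moments: D₀ = P₀, D₁ = P₁, D₃ = P₃ - 3P₂ + 2P₁.
module Submission where

open import Defs
open import Data.Nat as ℕ using (ℕ; zero; suc)
import Data.Nat.Properties as ℕP
open import Data.Nat.DivMod using (m*n/n≡m)
import Data.Nat.Coprimality as Coprime
open import Data.Integer as ℤ using (ℤ; +_; -[1+_])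
import Data.Integer.Properties as ℤP
open import Data.Rational as ℚ using (ℚ; mkℚ; _+_; _*_; -_; _/_; 1/_; 0ℚ; 1ℚ)
import Data.Rational.Properties as ℚP
open import Data.List using (List; []; _∷_; _++_; length; concatMap; filter; foldr; replicate)
open import Data.Bool using (Bool; true; false; if_then_else_; T)
open import Data.Bool.Properties using (T?)
open import Data.Unit using (⊤; tt)
open import Data.Product using (_×_; ∃; _,_)
open import Data.Sum using (inj₁; inj₂)
open import Data.Maybe using (Maybe; just; nothing)
open import Data.Fin using (zero)
open import Data.Vec using ([]; _∷_)
open import Relation.Nullary using (yes; no)
open import Relation.Binary.PropositionalEquality
open import Relation.Binary.Bundles using (Setoid)
open import Algebra.Bundles using (CommutativeRing; CommutativeMonoid)
open import Algebra.Solver.Ring.AlmostCommutativeRing using (fromCommutativeRing; _-Raw-AlmostCommutative⟶_)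
import Algebra.Solver.Ring
import Algebra.Properties.Ring
import Algebra.Properties.Semiring.Exp
import Relation.Binary.Reasoning.Setoid
import Data.Nat.Solver as ℕ-Solver
import Data.Rational.Solver as ℚ-Solver

-- Convolution and the ring of formal power series

fromℤ : ℤ → ℚ
fromℤ i = i / 1

fromℤ-mkℚ : ∀ i → fromℤ i ≡ mkℚ i 0 (Coprime.sym (Coprime.1-coprimeTo ℤ.∣ i ∣))
fromℤ-mkℚ (+ n)    = ℚP.normalize-coprime (Coprime.sym (Coprime.1-coprimeTo n))
fromℤ-mkℚ -[1+ n ] = cong -_ (ℚP.normalize-coprime (Coprime.sym (Coprime.1-coprimeTo (suc n))))

fromℤ-+ : ∀ i j → fromℤ (i ℤ.+ j) ≡ fromℤ i + fromℤ j
fromℤ-+ i j rewrite fromℤ-mkℚ i | fromℤ-mkℚ j =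
  cong (_/ 1) (cong₂ ℤ._+_ (sym (ℤP.*-identityʳ i)) (sym (ℤP.*-identityʳ j)))

fromℤ-* : ∀ i j → fromℤ (i ℤ.* j) ≡ fromℤ i * fromℤ j
fromℤ-* i j rewrite fromℤ-mkℚ i | fromℤ-mkℚ j = refl

fromℤ-neg : ∀ i → fromℤ (ℤ.- i) ≡ - fromℤ i
fromℤ-neg (+ zero)  = refl
fromℤ-neg (+ suc n) = refl
fromℤ-neg -[1+ n ]  = trans (fromℤ-mkℚ (+ suc n)) (sym (cong -_ (fromℤ-mkℚ -[1+ n ])))

fromℤ-suc : ∀ n → fromℤ (+ suc n) ≡ 1ℚ + fromℤ (+ n)
fromℤ-suc n = fromℤ-+ (+ 1) (+ n)

+-interchange : ∀ a b c d → (a + b) + (c + d) ≡ (a + c) + (b + d)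
+-interchange = interchange
  where open import Algebra.Properties.CommutativeSemigroup (CommutativeMonoid.commutativeSemigroup ℚP.+-0-commutativeMonoid)

splitSum : (ℕ → ℕ → ℚ) → ℕ → ℚ
splitSum K zero    = K 0 0
splitSum K (suc m) = K 0 (suc m) + splitSum (λ a b → K (suc a) b) m

splitSum-cong : ∀ {K L} → (∀ a b → K a b ≡ L a b) → ∀ m → splitSum K m ≡ splitSum L m
splitSum-cong e zero    = e 0 0
splitSum-cong e (suc m) = cong₂ _+_ (e 0 (suc m)) (splitSum-cong (λ a b → e (suc a) b) m)

splitSum-+ : ∀ K L m → splitSum (λ a b → K a b + L a b) m ≡ splitSum K m + splitSum L m
splitSum-+ K L zero    = refl
splitSum-+ K L (suc m) = begin
  (K 0 (suc m) + L 0 (suc m)) + splitSum (λ a b → K (suc a) b + L (suc a) b) m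
    ≡⟨ cong (_+_ (K 0 (suc m) + L 0 (suc m))) (splitSum-+ (λ a b → K (suc a) b) (λ a b → L (suc a) b) m) ⟩
  (K 0 (suc m) + L 0 (suc m)) + (splitSum (λ a b → K (suc a) b) m + splitSum (λ a b → L (suc a) b) m)
    ≡⟨ +-interchange (K 0 (suc m)) (L 0 (suc m)) (splitSum (λ a b → K (suc a) b) m) (splitSum (λ a b → L (suc a) b) m) ⟩
  splitSum K (suc m) + splitSum L (suc m) ∎
  where open ≡-Reasoning

splitSum-*ˡ : ∀ c K m → splitSum (λ a b → c * K a b) m ≡ c * splitSum K m
splitSum-*ˡ c K zero    = refl
splitSum-*ˡ c K (suc m) = trans (cong (_+_ (c * K 0 (suc m))) (splitSum-*ˡ c (λ a b → K (suc a) b) m))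
                                (sym (ℚP.*-distribˡ-+ c _ _))

splitSum-*ʳ : ∀ c K m → splitSum (λ a b → K a b * c) m ≡ splitSum K m * c
splitSum-*ʳ c K m = begin
  splitSum (λ a b → K a b * c) m ≡⟨ splitSum-cong (λ a b → ℚP.*-comm (K a b) c) m ⟩
  splitSum (λ a b → c * K a b) m ≡⟨ splitSum-*ˡ c K m ⟩
  c * splitSum K m               ≡⟨ ℚP.*-comm c _ ⟩
  splitSum K m * c ∎
  where open ≡-Reasoning

splitSum-vanish : ∀ {K} m → (∀ a b → b ℕ.≤ m → K a b ≡ 0ℚ) → splitSum K m ≡ 0ℚ
splitSum-vanish zero    e = e 0 0 ℕ.z≤n
splitSum-vanish (suc m) e = trans (cong₂ _+_ (e 0 (suc m) ℕP.≤-refl) (splitSum-vanish m (λ a b b≤m → e (suc a) b (ℕP.m≤n⇒m≤1+n b≤m))))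
                                  (ℚP.+-identityʳ 0ℚ)

splitSum-unsnoc : ∀ K m → splitSum K (suc m) ≡ splitSum (λ a b → K a (suc b)) m + K (suc m) 0
splitSum-unsnoc K zero    = refl
splitSum-unsnoc K (suc m) = trans (cong (_+_ (K 0 (suc (suc m)))) (splitSum-unsnoc (λ a b → K (suc a) b) m))
                                  (sym (ℚP.+-assoc (K 0 (suc (suc m))) (splitSum (λ a b → K (suc a) (suc b)) m) (K (suc (suc m)) 0)))

splitSum-swap : ∀ K m → splitSum K m ≡ splitSum (λ a b → K b a) m
splitSum-swap K zero    = refl
splitSum-swap K (suc m) = begin
  K 0 (suc m) + splitSum (λ a b → K (suc a) b) m   ≡⟨ cong (_+_ (K 0 (suc m))) (splitSum-swap (λ a b → K (suc a) b) m) ⟩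
  K 0 (suc m) + splitSum (λ a b → K (suc b) a) m   ≡⟨ ℚP.+-comm (K 0 (suc m)) (splitSum (λ a b → K (suc b) a) m) ⟩
  splitSum (λ a b → K (suc b) a) m + K 0 (suc m)   ≡⟨ splitSum-unsnoc (λ a b → K b a) m ⟨
  splitSum (λ a b → K b a) (suc m) ∎
  where open ≡-Reasoning

splitSum-assoc : ∀ (K : ℕ → ℕ → ℕ → ℚ) m →
  splitSum (λ a b → splitSum (λ c d → K c d b) a) m ≡ splitSum (λ c e → splitSum (λ d b → K c d b) e) m
splitSum-assoc K zero    = refl
splitSum-assoc K (suc m) = begin
  K 0 0 (suc m) + splitSum (λ a b → K 0 (suc a) b + splitSum (λ c d → K (suc c) d b) a) m
    ≡⟨ cong (_+_ (K 0 0 (suc m))) (splitSum-+ (λ a b → K 0 (suc a) b) _ m) ⟩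
  K 0 0 (suc m) + (splitSum (λ a b → K 0 (suc a) b) m + splitSum (λ a b → splitSum (λ c d → K (suc c) d b) a) m)
    ≡⟨ ℚP.+-assoc (K 0 0 (suc m)) (splitSum (λ a b → K 0 (suc a) b) m) (splitSum (λ a b → splitSum (λ c d → K (suc c) d b) a) m) ⟨
  (K 0 0 (suc m) + splitSum (λ a b → K 0 (suc a) b) m) + splitSum (λ a b → splitSum (λ c d → K (suc c) d b) a) m
    ≡⟨ cong (_+_ (K 0 0 (suc m) + splitSum (λ a b → K 0 (suc a) b) m)) (splitSum-assoc (λ c → K (suc c)) m) ⟩
  splitSum (λ c e → splitSum (λ d b → K c d b) e) (suc m) ∎
  where open ≡-Reasoning

convUpTo-splitSum : ∀ f g m j → convUpTo f g (m ℕ.+ j) m ≡ splitSum (λ a b → f a * g (b ℕ.+ j)) m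
convUpTo-splitSum f g zero    j = refl
convUpTo-splitSum f g (suc m) j = begin
  f (suc m) * g (suc m ℕ.+ j ℕ.∸ suc m) + convUpTo f g (suc m ℕ.+ j) m
    ≡⟨ ℚP.+-comm (f (suc m) * g (suc m ℕ.+ j ℕ.∸ suc m)) (convUpTo f g (suc m ℕ.+ j) m) ⟩
  convUpTo f g (suc m ℕ.+ j) m + f (suc m) * g (suc m ℕ.+ j ℕ.∸ suc m)
    ≡⟨ cong₂ (λ n t → convUpTo f g n m + f (suc m) * g t) (sym (ℕP.+-suc m j)) (ℕP.m+n∸m≡n (suc m) j) ⟩
  convUpTo f g (m ℕ.+ suc j) m + f (suc m) * g j
    ≡⟨ cong (_+ f (suc m) * g j) (convUpTo-splitSum f g m (suc j)) ⟩
  splitSum (λ a b → f a * g (b ℕ.+ suc j)) m + f (suc m) * g j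
    ≡⟨ cong (_+ f (suc m) * g j) (splitSum-cong (λ a b → cong (λ t → f a * g t) (ℕP.+-suc b j)) m) ⟩
  splitSum (λ a b → f a * g (suc b ℕ.+ j)) m + f (suc m) * g j
    ≡⟨ splitSum-unsnoc (λ a b → f a * g (b ℕ.+ j)) m ⟨
  splitSum (λ a b → f a * g (b ℕ.+ j)) (suc m) ∎
  where open ≡-Reasoning

⊗-splitSum : ∀ f g n → (f ⊗ g) n ≡ splitSum (λ a b → f a * g b) n
⊗-splitSum f g n = begin
  convUpTo f g n n                           ≡⟨ cong (λ k → convUpTo f g k n) (ℕP.+-identityʳ n) ⟨
  convUpTo f g (n ℕ.+ 0) n                   ≡⟨ convUpTo-splitSum f g n 0 ⟩
  splitSum (λ a b → f a * g (b ℕ.+ 0)) n     ≡⟨ splitSum-cong (λ a b → cong (λ t → f a * g t) (ℕP.+-identityʳ b)) n ⟩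
  splitSum (λ a b → f a * g b) n ∎
  where open ≡-Reasoning

0ₛ 1ₛ : FPS
0ₛ = cst 0ℚ
1ₛ = cst 1ℚ

0ₛ-coeff : ∀ n → 0ₛ n ≡ 0ℚ
0ₛ-coeff zero    = refl
0ₛ-coeff (suc n) = refl

≈ₛ-refl : ∀ {f} → f ≈ₛ f
≈ₛ-refl n = refl

≈ₛ-sym : ∀ {f g} → f ≈ₛ g → g ≈ₛ f
≈ₛ-sym e n = sym (e n)

≈ₛ-trans : ∀ {f g h} → f ≈ₛ g → g ≈ₛ h → f ≈ₛ h
≈ₛ-trans e e′ n = trans (e n) (e′ n)

⊕-cong : ∀ {f f′ g g′} → f ≈ₛ f′ → g ≈ₛ g′ → f ⊕ g ≈ₛ f′ ⊕ g′
⊕-cong e e′ n = cong₂ _+_ (e n) (e′ n)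

⊝-cong : ∀ {f f′} → f ≈ₛ f′ → ⊝ f ≈ₛ ⊝ f′
⊝-cong e n = cong -_ (e n)

⊗-cong : ∀ {f f′ g g′} → f ≈ₛ f′ → g ≈ₛ g′ → f ⊗ g ≈ₛ f′ ⊗ g′
⊗-cong {f} {f′} {g} {g′} e e′ n = begin
  (f ⊗ g) n                         ≡⟨ ⊗-splitSum f g n ⟩
  splitSum (λ a b → f a * g b) n    ≡⟨ splitSum-cong (λ a b → cong₂ _*_ (e a) (e′ b)) n ⟩
  splitSum (λ a b → f′ a * g′ b) n  ≡⟨ ⊗-splitSum f′ g′ n ⟨
  (f′ ⊗ g′) n ∎
  where open ≡-Reasoning

⊗-comm : ∀ f g → f ⊗ g ≈ₛ g ⊗ f
⊗-comm f g n = begin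
  (f ⊗ g) n                       ≡⟨ ⊗-splitSum f g n ⟩
  splitSum (λ a b → f a * g b) n  ≡⟨ splitSum-swap (λ a b → f a * g b) n ⟩
  splitSum (λ a b → f b * g a) n  ≡⟨ splitSum-cong (λ a b → ℚP.*-comm (f b) (g a)) n ⟩
  splitSum (λ a b → g a * f b) n  ≡⟨ ⊗-splitSum g f n ⟨
  (g ⊗ f) n ∎
  where open ≡-Reasoning

⊗-assoc : ∀ f g h → (f ⊗ g) ⊗ h ≈ₛ f ⊗ (g ⊗ h)
⊗-assoc f g h n = begin
  ((f ⊗ g) ⊗ h) n
    ≡⟨ ⊗-splitSum (f ⊗ g) h n ⟩
  splitSum (λ a b → (f ⊗ g) a * h b) n
    ≡⟨ splitSum-cong (λ a b → trans (cong (_* h b) (⊗-splitSum f g a)) (sym (splitSum-*ʳ (h b) _ a))) n ⟩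
  splitSum (λ a b → splitSum (λ c d → f c * g d * h b) a) n
    ≡⟨ splitSum-assoc (λ c d b → f c * g d * h b) n ⟩
  splitSum (λ c e → splitSum (λ d b → f c * g d * h b) e) n
    ≡⟨ splitSum-cong (λ c e → splitSum-cong (λ d b → ℚP.*-assoc (f c) (g d) (h b)) e) n ⟩
  splitSum (λ c e → splitSum (λ d b → f c * (g d * h b)) e) n
    ≡⟨ splitSum-cong (λ c e → trans (splitSum-*ˡ (f c) _ e) (cong (f c *_) (sym (⊗-splitSum g h e)))) n ⟩
  splitSum (λ c e → f c * (g ⊗ h) e) n
    ≡⟨ ⊗-splitSum f (g ⊗ h) n ⟨
  (f ⊗ (g ⊗ h)) n ∎
  where open ≡-Reasoning

cst-⊗ : ∀ c f n → (cst c ⊗ f) n ≡ c * f n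
cst-⊗ c f zero    = refl
cst-⊗ c f (suc n) = begin
  (cst c ⊗ f) (suc n)                         ≡⟨ ⊗-splitSum (cst c) f (suc n) ⟩
  c * f (suc n) + splitSum (λ _ b → 0ℚ * f b) n ≡⟨ cong (_+_ (c * f (suc n))) (splitSum-vanish n (λ _ b _ → ℚP.*-zeroˡ (f b))) ⟩
  c * f (suc n) + 0ℚ                          ≡⟨ ℚP.+-identityʳ _ ⟩
  c * f (suc n) ∎
  where open ≡-Reasoning

⊗-identityˡ : ∀ f → 1ₛ ⊗ f ≈ₛ f
⊗-identityˡ f n = trans (cst-⊗ 1ℚ f n) (ℚP.*-identityˡ (f n))

⊗-distribˡ : ∀ f g h → f ⊗ (g ⊕ h) ≈ₛ f ⊗ g ⊕ f ⊗ h
⊗-distribˡ f g h n = begin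
  (f ⊗ (g ⊕ h)) n
    ≡⟨ ⊗-splitSum f (g ⊕ h) n ⟩
  splitSum (λ a b → f a * (g b + h b)) n
    ≡⟨ splitSum-cong (λ a b → ℚP.*-distribˡ-+ (f a) (g b) (h b)) n ⟩
  splitSum (λ a b → f a * g b + f a * h b) n
    ≡⟨ splitSum-+ (λ a b → f a * g b) (λ a b → f a * h b) n ⟩
  splitSum (λ a b → f a * g b) n + splitSum (λ a b → f a * h b) n
    ≡⟨ cong₂ _+_ (⊗-splitSum f g n) (⊗-splitSum f h n) ⟨
  (f ⊗ g ⊕ f ⊗ h) n ∎
  where open ≡-Reasoning

≈ₛ-setoid : Setoid _ _
≈ₛ-setoid = record
  { Carrier = FPS ; _≈_ = _≈ₛ_
  ; isEquivalence = record { refl = λ {f} → ≈ₛ-refl {f} ; sym = λ {f} {g} → ≈ₛ-sym {f} {g} ; trans = λ {f} {g} {h} → ≈ₛ-trans {f} {g} {h} }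
  }

FPS-commutativeRing : CommutativeRing _ _
FPS-commutativeRing = record
  { Carrier = FPS
  ; _≈_ = _≈ₛ_
  ; _+_ = _⊕_
  ; _*_ = _⊗_
  ; -_ = ⊝_
  ; 0# = 0ₛ
  ; 1# = 1ₛ
  ; isCommutativeRing = record
    { isRing = record
      { +-isAbelianGroup = record
        { isGroup = record
          { isMonoid = record
            { isSemigroup = record
              { isMagma = record
                { isEquivalence = Setoid.isEquivalence ≈ₛ-setoid
                ; ∙-cong = λ {f} {f′} {g} {g′} → ⊕-cong {f} {f′} {g} {g′} }
              ; assoc = λ f g h n → ℚP.+-assoc (f n) (g n) (h n) }
            ; identity = comm∧idˡ⇒id ⊕-comm ⊕-identityˡ }
          ; inverse = comm∧invˡ⇒inv ⊕-comm ⊝-inverseˡ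
          ; ⁻¹-cong = λ {f} {f′} → ⊝-cong {f} {f′} }
        ; comm = ⊕-comm }
      ; *-cong = λ {f} {f′} {g} {g′} → ⊗-cong {f} {f′} {g} {g′}
      ; *-assoc = ⊗-assoc
      ; *-identity = comm∧idˡ⇒id ⊗-comm ⊗-identityˡ
      ; distrib = comm∧distrˡ⇒distr ⊕-cong ⊗-comm ⊗-distribˡ }
    ; *-comm = ⊗-comm }
  }
  where
  open import Algebra.Consequences.Setoid ≈ₛ-setoid using (comm∧idˡ⇒id; comm∧invˡ⇒inv; comm∧distrˡ⇒distr)
  ⊕-comm : ∀ f g → f ⊕ g ≈ₛ g ⊕ f
  ⊕-comm f g n = ℚP.+-comm (f n) (g n)
  ⊕-identityˡ : ∀ f → 0ₛ ⊕ f ≈ₛ f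
  ⊕-identityˡ f n = trans (cong (_+ f n) (0ₛ-coeff n)) (ℚP.+-identityˡ (f n))
  ⊝-inverseˡ : ∀ f → ⊝ f ⊕ f ≈ₛ 0ₛ
  ⊝-inverseˡ f n = trans (ℚP.+-inverseˡ (f n)) (sym (0ₛ-coeff n))

fromℤ-homomorphism : ℤ.+-*-rawRing -Raw-AlmostCommutative⟶ fromCommutativeRing FPS-commutativeRing
fromℤ-homomorphism = record
  { ⟦_⟧    = λ i → cst (fromℤ i)
  ; +-homo = λ { i j zero → fromℤ-+ i j ; i j (suc n) → sym (ℚP.+-identityʳ 0ℚ) }
  ; *-homo = λ { i j zero → fromℤ-* i j ; i j (suc n) → sym (trans (cst-⊗ (fromℤ i) (cst (fromℤ j)) (suc n)) (ℚP.*-zeroʳ (fromℤ i))) }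
  ; -‿homo = λ { i zero → fromℤ-neg i ; i (suc n) → refl }
  ; 0-homo = λ n → refl
  ; 1-homo = λ n → refl
  }

fromℤ-cst≟ : ∀ i j → Maybe (cst (fromℤ i) ≈ₛ cst (fromℤ j))
fromℤ-cst≟ i j with i ℤ.≟ j
... | yes refl = just ≈ₛ-refl
... | no _     = nothing

module FPS-Solver = Algebra.Solver.Ring ℤ.+-*-rawRing (fromCommutativeRing FPS-commutativeRing) fromℤ-homomorphism fromℤ-cst≟

module ≈ₛ-Reasoning = Relation.Binary.Reasoning.Setoid ≈ₛ-setoid

-- Sums over Dyck paths

sumList : ∀ {A : Set} → List A → (A → ℚ) → ℚ
sumList []       F = 0ℚ
sumList (x ∷ xs) F = F x + sumList xs F

sumList-++ : ∀ {A : Set} (xs ys : List A) F → sumList (xs ++ ys) F ≡ sumList xs F + sumList ys F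
sumList-++ []       ys F = sym (ℚP.+-identityˡ _)
sumList-++ (x ∷ xs) ys F = trans (cong (_+_ (F x)) (sumList-++ xs ys F)) (sym (ℚP.+-assoc (F x) _ _))

sumList-concatMap : ∀ {A B : Set} (g : A → List B) xs F →
  sumList (concatMap g xs) F ≡ sumList xs (λ x → sumList (g x) F)
sumList-concatMap g []       F = refl
sumList-concatMap g (x ∷ xs) F =
  trans (sumList-++ (g x) (concatMap g xs) F) (cong (_+_ (sumList (g x) F)) (sumList-concatMap g xs F))

sumList-cong : ∀ {A : Set} (xs : List A) {F G} → (∀ x → F x ≡ G x) → sumList xs F ≡ sumList xs G
sumList-cong []       e = refl
sumList-cong (x ∷ xs) e = cong₂ _+_ (e x) (sumList-cong xs e)

sumList-+ : ∀ {A : Set} (xs : List A) F G → sumList xs (λ x → F x + G x) ≡ sumList xs F + sumList xs G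
sumList-+ []       F G = refl
sumList-+ (x ∷ xs) F G = trans (cong (_+_ (F x + G x)) (sumList-+ xs F G)) (+-interchange (F x) (G x) _ _)

sumList-*ˡ : ∀ {A : Set} (xs : List A) c F → sumList xs (λ x → c * F x) ≡ c * sumList xs F
sumList-*ˡ []       c F = sym (ℚP.*-zeroʳ c)
sumList-*ˡ (x ∷ xs) c F = trans (cong (_+_ (c * F x)) (sumList-*ˡ xs c F)) (sym (ℚP.*-distribˡ-+ c (F x) _))

sumList-zero : ∀ {A : Set} (xs : List A) → sumList xs (λ _ → 0ℚ) ≡ 0ℚ
sumList-zero []       = refl
sumList-zero (x ∷ xs) = trans (ℚP.+-identityˡ _) (sumList-zero xs)

sumList-filter : ∀ {A : Set} (p : A → Bool) xs F →
  sumList (filter (λ x → T? (p x)) xs) F ≡ sumList xs (λ x → if p x then F x else 0ℚ)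
sumList-filter p []       F = refl
sumList-filter p (x ∷ xs) F with p x
... | true  = cong (_+_ (F x)) (sumList-filter p xs F)
... | false = trans (sumList-filter p xs F) (sym (ℚP.+-identityˡ _))

pathSum : ℕ → ℕ → (List Step → ℚ) → ℚ
pathSum h n F = sumList (words n) (λ w → if dyckFrom h w then F w else 0ℚ)

if-+ : ∀ b x y → (if b then x + y else 0ℚ) ≡ (if b then x else 0ℚ) + (if b then y else 0ℚ)
if-+ true  x y = refl
if-+ false x y = refl

if-*ˡ : ∀ b c x → (if b then c * x else 0ℚ) ≡ c * (if b then x else 0ℚ)
if-*ˡ true  c x = refl
if-*ˡ false c x = sym (ℚP.*-zeroʳ c)

if-zero : ∀ b → (if b then 0ℚ else 0ℚ) ≡ 0ℚ
if-zero true  = refl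
if-zero false = refl

pathSum-+ : ∀ h n F G → pathSum h n (λ w → F w + G w) ≡ pathSum h n F + pathSum h n G
pathSum-+ h n F G = trans (sumList-cong (words n) (λ w → if-+ (dyckFrom h w) (F w) (G w))) (sumList-+ (words n) _ _)

pathSum-*ˡ : ∀ h n c F → pathSum h n (λ w → c * F w) ≡ c * pathSum h n F
pathSum-*ˡ h n c F = trans (sumList-cong (words n) (λ w → if-*ˡ (dyckFrom h w) c (F w))) (sumList-*ˡ (words n) c _)

pathSum-*ʳ : ∀ h n c F → pathSum h n (λ w → F w * c) ≡ pathSum h n F * c
pathSum-*ʳ h n c F = begin
  pathSum h n (λ w → F w * c) ≡⟨ sumList-cong (words n) (λ w → cong (λ t → if dyckFrom h w then t else 0ℚ) (ℚP.*-comm (F w) c)) ⟩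
  pathSum h n (λ w → c * F w) ≡⟨ pathSum-*ˡ h n c F ⟩
  c * pathSum h n F           ≡⟨ ℚP.*-comm c _ ⟩
  pathSum h n F * c ∎
  where open ≡-Reasoning

pathSum-zero : ∀ h n → pathSum h n (λ _ → 0ℚ) ≡ 0ℚ
pathSum-zero h n = trans (sumList-cong (words n) (λ w → if-zero (dyckFrom h w))) (sumList-zero (words n))

dyckFrom-U : ∀ h w → dyckFrom h (U ∷ w) ≡ dyckFrom (suc h) w
dyckFrom-U zero    w = refl
dyckFrom-U (suc h) w = refl

pathSumDown : ℕ → ℕ → (List Step → ℚ) → ℚ
pathSumDown zero    n F = 0ℚ
pathSumDown (suc h) n F = pathSum h n (λ w → F (D ∷ w))

pathSum-suc : ∀ h n F → pathSum h (suc n) F ≡ pathSum (suc h) n (λ w → F (U ∷ w)) + pathSumDown h n F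
pathSum-suc h n F = begin
  pathSum h (suc n) F
    ≡⟨ sumList-concatMap (λ w → (U ∷ w) ∷ (D ∷ w) ∷ []) (words n) H ⟩
  sumList (words n) (λ w → H (U ∷ w) + (H (D ∷ w) + 0ℚ))
    ≡⟨ sumList-cong (words n) (λ w → cong (λ b → (if b then F (U ∷ w) else 0ℚ) + (H (D ∷ w) + 0ℚ)) (dyckFrom-U h w)) ⟩
  sumList (words n) (λ w → (if dyckFrom (suc h) w then F (U ∷ w) else 0ℚ) + (H (D ∷ w) + 0ℚ))
    ≡⟨ sumList-+ (words n) _ _ ⟩
  pathSum (suc h) n (λ w → F (U ∷ w)) + sumList (words n) (λ w → H (D ∷ w) + 0ℚ)
    ≡⟨ cong (_+_ (pathSum (suc h) n (λ w → F (U ∷ w)))) (down h) ⟩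
  pathSum (suc h) n (λ w → F (U ∷ w)) + pathSumDown h n F ∎
  where
  open ≡-Reasoning
  H : List Step → ℚ
  H w = if dyckFrom h w then F w else 0ℚ
  down : ∀ h → sumList (words n) (λ w → (if dyckFrom h (D ∷ w) then F (D ∷ w) else 0ℚ) + 0ℚ) ≡ pathSumDown h n F
  down zero    = sumList-zero (words n)
  down (suc g) = sumList-cong (words n) (λ w → ℚP.+-identityʳ _)

pathSum-cong : ∀ h n {F G} → (∀ w → length w ≡ n → T (dyckFrom h w) → F w ≡ G w) → pathSum h n F ≡ pathSum h n G
pathSum-cong zero    zero    e = cong (_+ 0ℚ) (e [] refl tt)
pathSum-cong (suc h) zero    e = refl
pathSum-cong h       (suc n) {F} {G} e = begin
  pathSum h (suc n) F                                      ≡⟨ pathSum-suc h n F ⟩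
  pathSum (suc h) n (λ w → F (U ∷ w)) + pathSumDown h n F
    ≡⟨ cong₂ _+_ (pathSum-cong (suc h) n (λ w l d → e (U ∷ w) (cong suc l) (subst T (sym (dyckFrom-U h w)) d))) (down h e) ⟩
  pathSum (suc h) n (λ w → G (U ∷ w)) + pathSumDown h n G ≡⟨ pathSum-suc h n G ⟨
  pathSum h (suc n) G ∎
  where
  open ≡-Reasoning
  down : ∀ h → (∀ w → length w ≡ suc n → T (dyckFrom h w) → F w ≡ G w) → pathSumDown h n F ≡ pathSumDown h n G
  down zero    e = refl
  down (suc g) e = pathSum-cong g n (λ w l d → e (D ∷ w) (cong suc l) d)

-- Cut a path from height g + 1 at its first visit to 0: it is u ++ D ∷ v with u a path from g to 0
-- (read one level higher) and v a Dyck path.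
pathSum-firstPassage : ∀ m g F →
  pathSum (suc g) (suc m) F ≡ splitSum (λ a b → pathSum g a (λ u → pathSum 0 b (λ v → F (u ++ D ∷ v)))) m
pathSum-firstPassage zero zero F =
  solve 1 (λ x → (con 0ℚ :+ con 0ℚ) :+ (x :+ con 0ℚ) := (x :+ con 0ℚ) :+ con 0ℚ) refl (F (D ∷ []))
  where open ℚ-Solver.+-*-Solver
pathSum-firstPassage zero    (suc g) F = refl
pathSum-firstPassage (suc m) g       F = begin
  pathSum (suc g) (suc (suc m)) F
    ≡⟨ pathSum-suc (suc g) (suc m) F ⟩
  pathSum (suc (suc g)) (suc m) (λ w → F (U ∷ w)) + pathSum g (suc m) (λ w → F (D ∷ w))
    ≡⟨ cong (_+ pathSum g (suc m) (λ w → F (D ∷ w))) (pathSum-firstPassage m (suc g) (λ w → F (U ∷ w))) ⟩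
  Up + pathSum g (suc m) (λ w → F (D ∷ w))
    ≡⟨ down g ⟩
  K 0 (suc m) + (Up + splitSum (λ a b → pathSumDown g a (H b)) m)
    ≡⟨ cong (_+_ (K 0 (suc m))) (splitSum-+ (λ a b → pathSum (suc g) a (λ u → H b (U ∷ u))) (λ a b → pathSumDown g a (H b)) m) ⟨
  K 0 (suc m) + splitSum (λ a b → pathSum (suc g) a (λ u → H b (U ∷ u)) + pathSumDown g a (H b)) m
    ≡⟨ cong (_+_ (K 0 (suc m))) (splitSum-cong (λ a b → sym (pathSum-suc g a (H b))) m) ⟩
  K 0 (suc m) + splitSum (λ a b → K (suc a) b) m ∎
  where
  open ≡-Reasoning
  H : ℕ → List Step → ℚ
  H b u = pathSum 0 b (λ v → F (u ++ D ∷ v))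
  K : ℕ → ℕ → ℚ
  K a b = pathSum g a (H b)
  Up : ℚ
  Up = splitSum (λ a b → pathSum (suc g) a (λ u → H b (U ∷ u))) m
  down : ∀ g → Up + pathSum g (suc m) (λ w → F (D ∷ w)) ≡ pathSum g 0 (H (suc m)) + (Up + splitSum (λ a b → pathSumDown g a (H b)) m)
  down zero = begin
    Up + pathSum 0 (suc m) (λ w → F (D ∷ w))                     ≡⟨ cong (_+_ Up) (ℚP.+-identityʳ _) ⟨
    Up + pathSum 0 0 (H (suc m))                                  ≡⟨ ℚP.+-comm Up _ ⟩
    pathSum 0 0 (H (suc m)) + Up                                  ≡⟨ cong (_+_ (pathSum 0 0 (H (suc m)))) (ℚP.+-identityʳ Up) ⟨
    pathSum 0 0 (H (suc m)) + (Up + 0ℚ)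
      ≡⟨ cong (λ t → pathSum 0 0 (H (suc m)) + (Up + t)) (splitSum-vanish m (λ _ _ _ → refl)) ⟨
    pathSum 0 0 (H (suc m)) + (Up + splitSum (λ a b → pathSumDown 0 a (H b)) m) ∎
  down (suc g′) = begin
    Up + pathSum (suc g′) (suc m) (λ w → F (D ∷ w))              ≡⟨ cong (_+_ Up) (pathSum-firstPassage m g′ (λ w → F (D ∷ w))) ⟩
    Up + splitSum (λ a b → pathSumDown (suc g′) a (H b)) m       ≡⟨ ℚP.+-identityˡ _ ⟨
    pathSum (suc g′) 0 (H (suc m)) + (Up + splitSum (λ a b → pathSumDown (suc g′) a (H b)) m) ∎

twiceAreaFrom-++ : ∀ g k u r → T (dyckFrom g u) →
  twiceAreaFrom (g ℕ.+ k) (u ++ r) ≡ twiceAreaFrom g u ℕ.+ 2 ℕ.* k ℕ.* length u ℕ.+ twiceAreaFrom k r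
twiceAreaFrom-++ zero k [] r d = cong (ℕ._+ twiceAreaFrom k r) (sym (ℕP.*-zeroʳ (2 ℕ.* k)))
twiceAreaFrom-++ g k (U ∷ u) r d rewrite twiceAreaFrom-++ (suc g) k u r (subst T (dyckFrom-U g u) d) =
  solve 5 (λ g k A L B → (g :+ k) :+ (con 1 :+ (g :+ k)) :+ (A :+ con 2 :* k :* L :+ B)
                       := (g :+ (con 1 :+ g) :+ A) :+ con 2 :* k :* (con 1 :+ L) :+ B) refl
          g k (twiceAreaFrom (suc g) u) (length u) (twiceAreaFrom k r)
  where open ℕ-Solver.+-*-Solver
twiceAreaFrom-++ (suc g) k (D ∷ u) r d rewrite twiceAreaFrom-++ g k u r d =
  solve 5 (λ g k A L B → (con 1 :+ g :+ k) :+ (g :+ k) :+ (A :+ con 2 :* k :* L :+ B)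
                       := ((con 1 :+ g) :+ g :+ A) :+ con 2 :* k :* (con 1 :+ L) :+ B) refl
          g k (twiceAreaFrom g u) (length u) (twiceAreaFrom k r)
  where open ℕ-Solver.+-*-Solver

twiceAreaFrom-even : ∀ h w → T (dyckFrom h w) → ∃ λ m → twiceAreaFrom h w ℕ.+ h ≡ m ℕ.* 2
twiceAreaFrom-even zero [] d = 0 , refl
twiceAreaFrom-even h (U ∷ w) d with twiceAreaFrom-even (suc h) w (subst T (dyckFrom-U h w) d)
... | m , e = m ℕ.+ h , (begin
  h ℕ.+ suc h ℕ.+ twiceAreaFrom (suc h) w ℕ.+ h
    ≡⟨ solve 2 (λ h t → h :+ (con 1 :+ h) :+ t :+ h := (t :+ (con 1 :+ h)) :+ h :* con 2) refl h (twiceAreaFrom (suc h) w) ⟩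
  (twiceAreaFrom (suc h) w ℕ.+ suc h) ℕ.+ h ℕ.* 2   ≡⟨ cong (ℕ._+ h ℕ.* 2) e ⟩
  m ℕ.* 2 ℕ.+ h ℕ.* 2                              ≡⟨ ℕP.*-distribʳ-+ 2 m h ⟨
  (m ℕ.+ h) ℕ.* 2 ∎)
  where
  open ≡-Reasoning
  open ℕ-Solver.+-*-Solver
twiceAreaFrom-even (suc g) (D ∷ w) d with twiceAreaFrom-even g w d
... | m , e = m ℕ.+ suc g , (begin
  suc g ℕ.+ g ℕ.+ twiceAreaFrom g w ℕ.+ suc g
    ≡⟨ solve 2 (λ g t → (con 1 :+ g) :+ g :+ t :+ (con 1 :+ g) := (t :+ g) :+ (con 1 :+ g) :* con 2) refl g (twiceAreaFrom g w) ⟩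
  (twiceAreaFrom g w ℕ.+ g) ℕ.+ suc g ℕ.* 2         ≡⟨ cong (ℕ._+ suc g ℕ.* 2) e ⟩
  m ℕ.* 2 ℕ.+ suc g ℕ.* 2                           ≡⟨ ℕP.*-distribʳ-+ 2 m (suc g) ⟨
  (m ℕ.+ suc g) ℕ.* 2 ∎)
  where
  open ≡-Reasoning
  open ℕ-Solver.+-*-Solver

twiceAreaFrom≡area*2 : ∀ u → T (isDyck u) → twiceAreaFrom 0 u ≡ area u ℕ.* 2
twiceAreaFrom≡area*2 u d with twiceAreaFrom-even 0 u d
... | m , e = begin
  twiceAreaFrom 0 u              ≡⟨ e′ ⟩
  m ℕ.* 2                        ≡⟨ cong (ℕ._* 2) (m*n/n≡m m 2) ⟨
  (m ℕ.* 2 ℕ./ 2) ℕ.* 2          ≡⟨ cong (λ t → (t ℕ./ 2) ℕ.* 2) e′ ⟨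
  area u ℕ.* 2 ∎
  where
  open ≡-Reasoning
  e′ : twiceAreaFrom 0 u ≡ m ℕ.* 2
  e′ = trans (sym (ℕP.+-identityʳ _)) e

-- lifting u by one level adds length u to its area, and the steps U, D add 1
area-firstReturn : ∀ u v → T (isDyck u) → T (isDyck v) →
  area (U ∷ (u ++ D ∷ v)) ≡ area u ℕ.+ suc (length u) ℕ.+ area v
area-firstReturn u v du dv = begin
  twiceAreaFrom 0 (U ∷ (u ++ D ∷ v)) ℕ./ 2
    ≡⟨ cong (λ t → suc t ℕ./ 2) (twiceAreaFrom-++ 0 1 u (D ∷ v) du) ⟩
  suc (twiceAreaFrom 0 u ℕ.+ 2 ℕ.* 1 ℕ.* length u ℕ.+ suc (twiceAreaFrom 0 v)) ℕ./ 2
    ≡⟨ cong₂ (λ a b → suc (a ℕ.+ 2 ℕ.* 1 ℕ.* length u ℕ.+ suc b) ℕ./ 2) (twiceAreaFrom≡area*2 u du) (twiceAreaFrom≡area*2 v dv) ⟩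
  suc (area u ℕ.* 2 ℕ.+ 2 ℕ.* 1 ℕ.* length u ℕ.+ suc (area v ℕ.* 2)) ℕ./ 2
    ≡⟨ cong (ℕ._/ 2) (solve 3 (λ a l b → con 1 :+ (a :* con 2 :+ con 2 :* con 1 :* l :+ (con 1 :+ b :* con 2))
                                       := (a :+ (con 1 :+ l) :+ b) :* con 2) refl (area u) (length u) (area v)) ⟩
  (area u ℕ.+ suc (length u) ℕ.+ area v) ℕ.* 2 ℕ./ 2
    ≡⟨ m*n/n≡m _ 2 ⟩
  area u ℕ.+ suc (length u) ℕ.+ area v ∎
  where
  open ≡-Reasoning
  open ℕ-Solver.+-*-Solver

-- Area moments and the first-return recursion

infixr 8 _^_
_^_ : ℚ → ℕ → ℚ
x ^ zero  = 1ℚ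
x ^ suc k = x * x ^ k

areaℚ : List Step → ℚ
areaℚ w = fromℤ (+ area w)

moment : ℕ → FPS
moment k n = pathSum 0 n (λ w → areaℚ w ^ k)

-- weighted β f = (1 + x d/dx)^β f
weighted : ℕ → FPS → FPS
weighted zero    f n = f n
weighted (suc β) f n = fromℤ (+ suc n) * weighted β f n

weighted-coeff : ∀ β f n → weighted β f n ≡ fromℤ (+ suc n) ^ β * f n
weighted-coeff zero    f n = sym (ℚP.*-identityˡ (f n))
weighted-coeff (suc β) f n = trans (cong (fromℤ (+ suc n) *_) (weighted-coeff β f n)) (sym (ℚP.*-assoc (fromℤ (+ suc n)) (fromℤ (+ suc n) ^ β) (f n)))

moment-firstReturn : ∀ k m → moment k (suc (suc m))
  ≡ splitSum (λ a b → pathSum 0 a (λ u → pathSum 0 b (λ v → (areaℚ u + fromℤ (+ suc a) + areaℚ v) ^ k))) m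
moment-firstReturn k m = begin
  moment k (suc (suc m))
    ≡⟨ pathSum-suc 0 (suc m) F ⟩
  pathSum 1 (suc m) (λ w → F (U ∷ w)) + 0ℚ
    ≡⟨ ℚP.+-identityʳ _ ⟩
  pathSum 1 (suc m) (λ w → F (U ∷ w))
    ≡⟨ pathSum-firstPassage m 0 (λ w → F (U ∷ w)) ⟩
  splitSum (λ a b → pathSum 0 a (λ u → pathSum 0 b (λ v → F (U ∷ (u ++ D ∷ v))))) m
    ≡⟨ splitSum-cong (λ a b → pathSum-cong 0 a (λ u lu du → pathSum-cong 0 b (λ v _ dv →
         cong (_^ k) (areaℚ-firstReturn u v a lu du dv)))) m ⟩
  splitSum (λ a b → pathSum 0 a (λ u → pathSum 0 b (λ v → (areaℚ u + fromℤ (+ suc a) + areaℚ v) ^ k))) m ∎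
  where
  open ≡-Reasoning
  F : List Step → ℚ
  F w = areaℚ w ^ k
  areaℚ-firstReturn : ∀ u v a → length u ≡ a → T (isDyck u) → T (isDyck v) →
    areaℚ (U ∷ (u ++ D ∷ v)) ≡ areaℚ u + fromℤ (+ suc a) + areaℚ v
  areaℚ-firstReturn u v a refl du dv = begin
    fromℤ (+ area (U ∷ (u ++ D ∷ v)))                         ≡⟨ cong (λ t → fromℤ (+ t)) (area-firstReturn u v du dv) ⟩
    fromℤ (+ (area u ℕ.+ suc (length u) ℕ.+ area v))          ≡⟨ fromℤ-+ (+ (area u ℕ.+ suc (length u))) (+ area v) ⟩
    fromℤ (+ (area u ℕ.+ suc (length u))) + areaℚ v           ≡⟨ cong (_+ areaℚ v) (fromℤ-+ (+ area u) (+ suc (length u))) ⟩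
    areaℚ u + fromℤ (+ suc (length u)) + areaℚ v ∎

-- term c α β γ is the monomial c A^α L^β B^γ
data Term : Set where
  term : ℤ → ℕ → ℕ → ℕ → Term

evalTerms : List Term → ℚ → ℚ → ℚ → ℚ
evalTerms []                   A L B = 0ℚ
evalTerms (term c α β γ ∷ ts)  A L B = fromℤ c * (L ^ β * (A ^ α * B ^ γ)) + evalTerms ts A L B

termSeries : List Term → FPS
termSeries []                  = 0ₛ
termSeries (term c α β γ ∷ ts) = cst (fromℤ c) ⊗ (weighted β (moment α) ⊗ moment γ) ⊕ termSeries ts

termSeries-splitSum : ∀ ts m →
  splitSum (λ a b → pathSum 0 a (λ u → pathSum 0 b (λ v → evalTerms ts (areaℚ u) (fromℤ (+ suc a)) (areaℚ v)))) m
  ≡ termSeries ts m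
termSeries-splitSum [] m = begin
  splitSum (λ a b → pathSum 0 a (λ u → pathSum 0 b (λ _ → 0ℚ))) m
    ≡⟨ splitSum-vanish m (λ a b _ → trans (pathSum-cong 0 a (λ u _ _ → pathSum-zero 0 b)) (pathSum-zero 0 a)) ⟩
  0ℚ ≡⟨ 0ₛ-coeff m ⟨
  0ₛ m ∎
  where open ≡-Reasoning
termSeries-splitSum (term c α β γ ∷ ts) m = begin
  splitSum (λ a b → pathSum 0 a (λ u → pathSum 0 b (λ v → Mono a u v + Rest a u v))) m
    ≡⟨ splitSum-cong (λ a b → trans (pathSum-cong 0 a (λ u _ _ → pathSum-+ 0 b _ _)) (pathSum-+ 0 a _ _)) m ⟩
  splitSum (λ a b → pathSum 0 a (λ u → pathSum 0 b (Mono a u)) + pathSum 0 a (λ u → pathSum 0 b (Rest a u))) m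
    ≡⟨ splitSum-+ _ _ m ⟩
  splitSum (λ a b → pathSum 0 a (λ u → pathSum 0 b (Mono a u))) m + splitSum (λ a b → pathSum 0 a (λ u → pathSum 0 b (Rest a u))) m
    ≡⟨ cong₂ _+_ (splitSum-cong factor m) (termSeries-splitSum ts m) ⟩
  splitSum (λ a b → fromℤ c * (weighted β (moment α) a * moment γ b)) m + termSeries ts m
    ≡⟨ cong (_+ termSeries ts m) (splitSum-*ˡ (fromℤ c) _ m) ⟩
  fromℤ c * splitSum (λ a b → weighted β (moment α) a * moment γ b) m + termSeries ts m
    ≡⟨ cong (λ t → fromℤ c * t + termSeries ts m) (⊗-splitSum (weighted β (moment α)) (moment γ) m) ⟨
  fromℤ c * (weighted β (moment α) ⊗ moment γ) m + termSeries ts m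
    ≡⟨ cong (_+ termSeries ts m) (cst-⊗ (fromℤ c) _ m) ⟨
  termSeries (term c α β γ ∷ ts) m ∎
  where
  open ≡-Reasoning
  Mono Rest : ℕ → List Step → List Step → ℚ
  Mono a u v = fromℤ c * (fromℤ (+ suc a) ^ β * (areaℚ u ^ α * areaℚ v ^ γ))
  Rest a u v = evalTerms ts (areaℚ u) (fromℤ (+ suc a)) (areaℚ v)
  factor : ∀ a b → pathSum 0 a (λ u → pathSum 0 b (Mono a u)) ≡ fromℤ c * (weighted β (moment α) a * moment γ b)
  factor a b = begin
    pathSum 0 a (λ u → pathSum 0 b (Mono a u))
      ≡⟨ pathSum-cong 0 a (λ u _ _ → trans (pathSum-*ˡ 0 b (fromℤ c) _)
           (cong (fromℤ c *_) (trans (pathSum-*ˡ 0 b (fromℤ (+ suc a) ^ β) _) (cong (fromℤ (+ suc a) ^ β *_) (pathSum-*ˡ 0 b (areaℚ u ^ α) _))))) ⟩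
    pathSum 0 a (λ u → fromℤ c * (fromℤ (+ suc a) ^ β * (areaℚ u ^ α * moment γ b)))
      ≡⟨ trans (pathSum-*ˡ 0 a (fromℤ c) _) (cong (fromℤ c *_) (pathSum-*ˡ 0 a (fromℤ (+ suc a) ^ β) _)) ⟩
    fromℤ c * (fromℤ (+ suc a) ^ β * pathSum 0 a (λ u → areaℚ u ^ α * moment γ b))
      ≡⟨ cong (λ t → fromℤ c * (fromℤ (+ suc a) ^ β * t)) (pathSum-*ʳ 0 a (moment γ b) _) ⟩
    fromℤ c * (fromℤ (+ suc a) ^ β * (moment α a * moment γ b))
      ≡⟨ cong (fromℤ c *_) (ℚP.*-assoc (fromℤ (+ suc a) ^ β) (moment α a) (moment γ b)) ⟨
    fromℤ c * (fromℤ (+ suc a) ^ β * moment α a * moment γ b)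
      ≡⟨ cong (λ t → fromℤ c * (t * moment γ b)) (weighted-coeff β (moment α) a) ⟨
    fromℤ c * (weighted β (moment α) a * moment γ b) ∎

X²⊗-coeff : ∀ f m → (X^ 2 ⊗ f) (suc (suc m)) ≡ f m
X²⊗-coeff f m = begin
  (X^ 2 ⊗ f) (suc (suc m))
    ≡⟨ ⊗-splitSum (X^ 2) f (suc (suc m)) ⟩
  0ℚ * f (suc (suc m)) + (0ℚ * f (suc m) + splitSum (λ a b → X^ 2 (suc (suc a)) * f b) m)
    ≡⟨ cong₂ (λ x y → x + (y + splitSum (λ a b → X^ 2 (suc (suc a)) * f b) m)) (ℚP.*-zeroˡ (f (suc (suc m)))) (ℚP.*-zeroˡ (f (suc m))) ⟩
  0ℚ + (0ℚ + splitSum (λ a b → X^ 2 (suc (suc a)) * f b) m)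
    ≡⟨ trans (ℚP.+-identityˡ _) (ℚP.+-identityˡ _) ⟩
  splitSum (λ a b → X^ 2 (suc (suc a)) * f b) m
    ≡⟨ leading m ⟩
  f m ∎
  where
  open ≡-Reasoning
  leading : ∀ m → splitSum (λ a b → X^ 2 (suc (suc a)) * f b) m ≡ f m
  leading zero    = ℚP.*-identityˡ (f 0)
  leading (suc m) = begin
    1ℚ * f (suc m) + splitSum (λ a b → 0ℚ * f b) m ≡⟨ cong₂ _+_ (ℚP.*-identityˡ (f (suc m))) (splitSum-vanish m (λ _ b _ → ℚP.*-zeroˡ (f b))) ⟩
    f (suc m) + 0ℚ
      ≡⟨ ℚP.+-identityʳ _ ⟩
    f (suc m) ∎

moment-recursion : ∀ k ts → (∀ A L B → (A + L + B) ^ k ≡ evalTerms ts A L B) →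
  moment k ≈ₛ cst (moment k 0) ⊕ X^ 2 ⊗ termSeries ts
moment-recursion k ts expand zero = begin
  moment k 0                                 ≡⟨ ℚP.+-identityʳ _ ⟨
  moment k 0 + 0ℚ                            ≡⟨ cong (_+_ (moment k 0)) (ℚP.*-zeroˡ (termSeries ts 0)) ⟨
  moment k 0 + 0ℚ * termSeries ts 0 ∎
  where open ≡-Reasoning
moment-recursion k ts expand (suc zero) = begin
  0ℚ                                                       ≡⟨ ℚP.+-identityʳ 0ℚ ⟨
  0ℚ + 0ℚ                                                  ≡⟨ cong₂ _+_ (ℚP.*-zeroˡ (termSeries ts 0)) (ℚP.*-zeroˡ (termSeries ts 1)) ⟨
  0ℚ * termSeries ts 0 + 0ℚ * termSeries ts 1              ≡⟨ ℚP.+-identityˡ _ ⟨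
  0ℚ + (0ℚ * termSeries ts 0 + 0ℚ * termSeries ts 1) ∎
  where open ≡-Reasoning
moment-recursion k ts expand (suc (suc m)) = begin
  moment k (suc (suc m))
    ≡⟨ moment-firstReturn k m ⟩
  splitSum (λ a b → pathSum 0 a (λ u → pathSum 0 b (λ v → (areaℚ u + fromℤ (+ suc a) + areaℚ v) ^ k))) m
    ≡⟨ splitSum-cong (λ a b → pathSum-cong 0 a (λ u _ _ → pathSum-cong 0 b (λ v _ _ → expand _ _ _))) m ⟩
  splitSum (λ a b → pathSum 0 a (λ u → pathSum 0 b (λ v → evalTerms ts (areaℚ u) (fromℤ (+ suc a)) (areaℚ v)))) m
    ≡⟨ termSeries-splitSum ts m ⟩
  termSeries ts m
    ≡⟨ X²⊗-coeff (termSeries ts) m ⟨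
  (X^ 2 ⊗ termSeries ts) (suc (suc m))
    ≡⟨ ℚP.+-identityˡ _ ⟨
  (cst (moment k 0) ⊕ X^ 2 ⊗ termSeries ts) (suc (suc m)) ∎
  where open ≡-Reasoning

module TrinomialExpansions where
  open ℚ-Solver.+-*-Solver

  private
    termsExpr : List Term → Polynomial 3 → Polynomial 3 → Polynomial 3 → Polynomial 3
    termsExpr []                  A L B = con 0ℚ
    termsExpr (term c α β γ ∷ ts) A L B = con (fromℤ c) :* (L :^ β :* (A :^ α :* B :^ γ)) :+ termsExpr ts A L B

  pureTerms : ℕ → List Term
  pureTerms k = term (+ 1) k 0 0 ∷ term (+ 1) 0 0 k ∷ []

  mixed₁ mixed₂ mixed₃ : List Term
  mixed₁ = term (+ 1) 0 1 0 ∷ []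
  mixed₂ = term (+ 1) 0 2 0 ∷ term (+ 2) 1 1 0 ∷ term (+ 2) 1 0 1 ∷ term (+ 2) 0 1 1 ∷ []
  mixed₃ = term (+ 3) 0 1 2 ∷ term (+ 3) 0 2 1 ∷ term (+ 1) 0 3 0 ∷ term (+ 3) 1 0 2 ∷ term (+ 6) 1 1 1
         ∷ term (+ 3) 1 2 0 ∷ term (+ 3) 2 0 1 ∷ term (+ 3) 2 1 0 ∷ []

  expand₀ : ∀ A L B → (A + L + B) ^ 0 ≡ evalTerms (term (+ 1) 0 0 0 ∷ []) A L B
  expand₀ _ _ _ = refl

  expand₁ : ∀ A L B → (A + L + B) ^ 1 ≡ evalTerms (pureTerms 1 ++ mixed₁) A L B
  expand₁ = solve 3 (λ A L B → (A :+ L :+ B) :^ 1 := termsExpr (pureTerms 1 ++ mixed₁) A L B) refl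

  expand₂ : ∀ A L B → (A + L + B) ^ 2 ≡ evalTerms (pureTerms 2 ++ mixed₂) A L B
  expand₂ = solve 3 (λ A L B → (A :+ L :+ B) :^ 2 := termsExpr (pureTerms 2 ++ mixed₂) A L B) refl

  expand₃ : ∀ A L B → (A + L + B) ^ 3 ≡ evalTerms (pureTerms 3 ++ mixed₃) A L B
  expand₃ = solve 3 (λ A L B → (A :+ L :+ B) :^ 3 := termsExpr (pureTerms 3 ++ mixed₃) A L B) refl

open TrinomialExpansions

-- Derivatives in q at q = 1

+ₚ-identityʳ : ∀ p → p +ₚ [] ≡ p
+ₚ-identityʳ []      = refl
+ₚ-identityʳ (x ∷ p) = refl

derivFrom-+ₚ : ∀ i p q → derivFrom i (p +ₚ q) ≡ derivFrom i p +ₚ derivFrom i q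
derivFrom-+ₚ i []      q       = refl
derivFrom-+ₚ i (a ∷ p) []      = sym (+ₚ-identityʳ _)
derivFrom-+ₚ i (a ∷ p) (b ∷ q) = cong₂ _∷_ (ℚP.*-distribˡ-+ (fromℤ (+ i)) a b) (derivFrom-+ₚ (suc i) p q)

deriv-+ₚ : ∀ p q → deriv (p +ₚ q) ≡ deriv p +ₚ deriv q
deriv-+ₚ []      q       = refl
deriv-+ₚ (a ∷ p) []      = sym (+ₚ-identityʳ _)
deriv-+ₚ (a ∷ p) (b ∷ q) = derivFrom-+ₚ 1 p q

derivN-+ₚ : ∀ k p q → derivN k (p +ₚ q) ≡ derivN k p +ₚ derivN k q
derivN-+ₚ zero    p q = refl
derivN-+ₚ (suc k) p q = trans (cong deriv (derivN-+ₚ k p q)) (deriv-+ₚ (derivN k p) (derivN k q))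

derivN-[] : ∀ k → derivN k [] ≡ []
derivN-[] zero    = refl
derivN-[] (suc k) = cong deriv (derivN-[] k)

derivN-suc : ∀ k p → derivN (suc k) p ≡ derivN k (deriv p)
derivN-suc zero    p = refl
derivN-suc (suc k) p = cong deriv (derivN-suc k p)

eval-+ₚ : ∀ t p q → eval t (p +ₚ q) ≡ eval t p + eval t q
eval-+ₚ t []      q       = sym (ℚP.+-identityˡ _)
eval-+ₚ t (a ∷ p) []      = sym (ℚP.+-identityʳ _)
eval-+ₚ t (a ∷ p) (b ∷ q) rewrite eval-+ₚ t p q =
  solve 5 (λ a b t x y → (a :+ b) :+ t :* (x :+ y) := (a :+ t :* x) :+ (b :+ t :* y)) refl a b t (eval t p) (eval t q)
  where open ℚ-Solver.+-*-Solver

scaledMonomial : ℚ → ℕ → Poly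
scaledMonomial c a = replicate a 0ℚ ++ (c ∷ [])

derivFrom-scaledMonomial : ∀ i c a → derivFrom i (scaledMonomial c a) ≡ scaledMonomial (fromℤ (+ (i ℕ.+ a)) * c) a
derivFrom-scaledMonomial i c zero    = cong (λ j → (fromℤ (+ j) * c) ∷ []) (sym (ℕP.+-identityʳ i))
derivFrom-scaledMonomial i c (suc a) = cong₂ _∷_ (ℚP.*-zeroʳ (fromℤ (+ i)))
  (trans (derivFrom-scaledMonomial (suc i) c a) (cong (λ j → scaledMonomial (fromℤ (+ j) * c) a) (sym (ℕP.+-suc i a))))

eval1-scaledMonomial : ∀ c a → eval 1ℚ (scaledMonomial c a) ≡ c
eval1-scaledMonomial c zero    = trans (cong (_+_ c) (ℚP.*-zeroʳ 1ℚ)) (ℚP.+-identityʳ c)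
eval1-scaledMonomial c (suc a) = trans (cong (λ t → 0ℚ + 1ℚ * t) (eval1-scaledMonomial c a)) (trans (ℚP.+-identityˡ _) (ℚP.*-identityˡ c))

fallingFactorial : ℕ → ℕ → ℚ
fallingFactorial a       zero    = 1ℚ
fallingFactorial zero    (suc k) = 0ℚ
fallingFactorial (suc a) (suc k) = fromℤ (+ suc a) * fallingFactorial a k

derivN-scaledMonomial-at1 : ∀ k c a → eval 1ℚ (derivN k (scaledMonomial c a)) ≡ c * fallingFactorial a k
derivN-scaledMonomial-at1 zero c a = trans (eval1-scaledMonomial c a) (sym (ℚP.*-identityʳ c))
derivN-scaledMonomial-at1 (suc k) c zero = begin
  eval 1ℚ (derivN (suc k) (c ∷ []))  ≡⟨ cong (eval 1ℚ) (trans (derivN-suc k (c ∷ [])) (derivN-[] k)) ⟩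
  0ℚ                                 ≡⟨ ℚP.*-zeroʳ c ⟨
  c * 0ℚ ∎
  where open ≡-Reasoning
derivN-scaledMonomial-at1 (suc k) c (suc a) = begin
  eval 1ℚ (derivN (suc k) (scaledMonomial c (suc a)))
    ≡⟨ cong (eval 1ℚ) (trans (derivN-suc k _) (cong (derivN k) (derivFrom-scaledMonomial 1 c a))) ⟩
  eval 1ℚ (derivN k (scaledMonomial (fromℤ (+ suc a) * c) a))
    ≡⟨ derivN-scaledMonomial-at1 k (fromℤ (+ suc a) * c) a ⟩
  fromℤ (+ suc a) * c * fallingFactorial a k
    ≡⟨ solve 3 (λ x y z → x :* y :* z := y :* (x :* z)) refl (fromℤ (+ suc a)) c (fallingFactorial a k) ⟩
  c * fallingFactorial (suc a) (suc k) ∎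
  where
  open ≡-Reasoning
  open ℚ-Solver.+-*-Solver

DqAt1-pathSum : ∀ k n → DqAt1 k n ≡ pathSum 0 n (λ w → fallingFactorial (area w) k)
DqAt1-pathSum k n = trans (sumOver (dyckPaths n)) (sumList-filter isDyck (words n) (λ w → fallingFactorial (area w) k))
  where
  open ≡-Reasoning
  sumOver : ∀ Ps → eval 1ℚ (derivN k (foldr (λ P acc → monomial (area P) +ₚ acc) [] Ps)) ≡ sumList Ps (λ P → fallingFactorial (area P) k)
  sumOver [] = cong (eval 1ℚ) (derivN-[] k)
  sumOver (P ∷ Ps) = begin
    eval 1ℚ (derivN k (monomial (area P) +ₚ rest))
      ≡⟨ cong (eval 1ℚ) (derivN-+ₚ k (monomial (area P)) rest) ⟩
    eval 1ℚ (derivN k (monomial (area P)) +ₚ derivN k rest)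
      ≡⟨ eval-+ₚ 1ℚ (derivN k (monomial (area P))) (derivN k rest) ⟩
    eval 1ℚ (derivN k (monomial (area P))) + eval 1ℚ (derivN k rest)
      ≡⟨ cong₂ _+_ (trans (derivN-scaledMonomial-at1 k 1ℚ (area P)) (ℚP.*-identityˡ (fallingFactorial (area P) k))) (sumOver Ps) ⟩
    sumList (P ∷ Ps) (λ P → fallingFactorial (area P) k) ∎
    where
    rest : Poly
    rest = foldr (λ P acc → monomial (area P) +ₚ acc) [] Ps

DqAt1-moment₀ : DqAt1 0 ≈ₛ moment 0
DqAt1-moment₀ = DqAt1-pathSum 0

DqAt1-moment₁ : DqAt1 1 ≈ₛ moment 1
DqAt1-moment₁ n = trans (DqAt1-pathSum 1 n) (pathSum-cong 0 n (λ w _ _ → falling₁ (area w)))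
  where
  falling₁ : ∀ a → fallingFactorial a 1 ≡ fromℤ (+ a) ^ 1
  falling₁ zero    = refl
  falling₁ (suc a) = refl

fallingFactorial₃ : ∀ a → fallingFactorial a 3 ≡ fromℤ (+ a) ^ 3 + fromℤ (-[1+ 2 ]) * fromℤ (+ a) ^ 2 + fromℤ (+ 2) * fromℤ (+ a) ^ 1
fallingFactorial₃ zero                = refl
fallingFactorial₃ (suc zero)          = refl
fallingFactorial₃ (suc (suc zero))    = refl
fallingFactorial₃ (suc (suc (suc b))) rewrite fromℤ-suc (suc (suc b)) | fromℤ-suc (suc b) | fromℤ-suc b =
  solve 1 (λ x → let x₁ = con 1ℚ :+ x ; x₂ = con 1ℚ :+ x₁ ; x₃ = con 1ℚ :+ x₂ in
                 x₃ :* (x₂ :* (x₁ :* con 1ℚ))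
                 := x₃ :* (x₃ :* (x₃ :* con 1ℚ)) :+ con (fromℤ (-[1+ 2 ])) :* (x₃ :* (x₃ :* con 1ℚ)) :+ con (fromℤ (+ 2)) :* (x₃ :* con 1ℚ))
          refl (fromℤ (+ b))
  where open ℚ-Solver.+-*-Solver

DqAt1-moment₃ : DqAt1 3 ≈ₛ moment 3 ⊕ cst (fromℤ (-[1+ 2 ])) ⊗ moment 2 ⊕ cst (fromℤ (+ 2)) ⊗ moment 1
DqAt1-moment₃ n = begin
  DqAt1 3 n
    ≡⟨ DqAt1-pathSum 3 n ⟩
  pathSum 0 n (λ w → fallingFactorial (area w) 3)
    ≡⟨ pathSum-cong 0 n (λ w _ _ → fallingFactorial₃ (area w)) ⟩
  pathSum 0 n (λ w → areaℚ w ^ 3 + fromℤ (-[1+ 2 ]) * areaℚ w ^ 2 + fromℤ (+ 2) * areaℚ w ^ 1)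
    ≡⟨ trans (pathSum-+ 0 n _ _) (cong₂ _+_ (pathSum-+ 0 n _ _) (pathSum-*ˡ 0 n (fromℤ (+ 2)) _)) ⟩
  moment 3 n + pathSum 0 n (λ w → fromℤ (-[1+ 2 ]) * areaℚ w ^ 2) + fromℤ (+ 2) * moment 1 n
    ≡⟨ cong (λ t → moment 3 n + t + fromℤ (+ 2) * moment 1 n) (pathSum-*ˡ 0 n (fromℤ (-[1+ 2 ])) _) ⟩
  moment 3 n + fromℤ (-[1+ 2 ]) * moment 2 n + fromℤ (+ 2) * moment 1 n
    ≡⟨ cong₂ (λ a b → moment 3 n + a + b) (cst-⊗ (fromℤ (-[1+ 2 ])) (moment 2) n) (cst-⊗ (fromℤ (+ 2)) (moment 1) n) ⟨
  (moment 3 ⊕ cst (fromℤ (-[1+ 2 ])) ⊗ moment 2 ⊕ cst (fromℤ (+ 2)) ⊗ moment 1) n ∎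
  where open ≡-Reasoning

-- The Euler operator x d/dx

euler : FPS → FPS
euler f n = fromℤ (+ n) * f n

euler-cong : ∀ {f g} → f ≈ₛ g → euler f ≈ₛ euler g
euler-cong e n = cong (fromℤ (+ n) *_) (e n)

euler-⊕ : ∀ f g → euler (f ⊕ g) ≈ₛ euler f ⊕ euler g
euler-⊕ f g n = ℚP.*-distribˡ-+ (fromℤ (+ n)) (f n) (g n)

euler-⊝ : ∀ f → euler (⊝ f) ≈ₛ ⊝ euler f
euler-⊝ f n = sym (ℚP.neg-distribʳ-* (fromℤ (+ n)) (f n))

euler-cst : ∀ c → euler (cst c) ≈ₛ 0ₛ
euler-cst c zero    = ℚP.*-zeroˡ c
euler-cst c (suc n) = ℚP.*-zeroʳ (fromℤ (+ suc n))

splitSum-leibniz : ∀ K m → fromℤ (+ m) * splitSum K m ≡ splitSum (λ a b → fromℤ (+ a) * K a b + fromℤ (+ b) * K a b) m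
splitSum-leibniz K zero = solve 1 (λ k → con 0ℚ :* k := con 0ℚ :* k :+ con 0ℚ :* k) refl (K 0 0)
  where open ℚ-Solver.+-*-Solver
splitSum-leibniz K (suc m) = begin
  fromℤ (+ suc m) * (K 0 (suc m) + S)
    ≡⟨ cong (_* (K 0 (suc m) + S)) (fromℤ-suc m) ⟩
  (1ℚ + fromℤ (+ m)) * (K 0 (suc m) + S)
    ≡⟨ solve 3 (λ x k s → (con 1ℚ :+ x) :* (k :+ s) := (con 0ℚ :* k :+ (con 1ℚ :+ x) :* k) :+ (s :+ x :* s)) refl (fromℤ (+ m)) (K 0 (suc m)) S ⟩
  (0ℚ * K 0 (suc m) + (1ℚ + fromℤ (+ m)) * K 0 (suc m)) + (S + fromℤ (+ m) * S)
    ≡⟨ cong₂ (λ x y → (0ℚ * K 0 (suc m) + x * K 0 (suc m)) + (S + y)) (sym (fromℤ-suc m)) (splitSum-leibniz (λ a b → K (suc a) b) m) ⟩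
  (0ℚ * K 0 (suc m) + fromℤ (+ suc m) * K 0 (suc m)) + (S + splitSum (λ a b → fromℤ (+ a) * K (suc a) b + fromℤ (+ b) * K (suc a) b) m)
    ≡⟨ cong (_+_ (0ℚ * K 0 (suc m) + fromℤ (+ suc m) * K 0 (suc m))) (trans (sym (splitSum-+ (λ a b → K (suc a) b) _ m)) (splitSum-cong shift m)) ⟩
  (0ℚ * K 0 (suc m) + fromℤ (+ suc m) * K 0 (suc m)) + splitSum (λ a b → fromℤ (+ suc a) * K (suc a) b + fromℤ (+ b) * K (suc a) b) m ∎
  where
  open ≡-Reasoning
  open ℚ-Solver.+-*-Solver
  S : ℚ
  S = splitSum (λ a b → K (suc a) b) m
  shift : ∀ a b → K (suc a) b + (fromℤ (+ a) * K (suc a) b + fromℤ (+ b) * K (suc a) b)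
                ≡ fromℤ (+ suc a) * K (suc a) b + fromℤ (+ b) * K (suc a) b
  shift a b rewrite fromℤ-suc a =
    solve 3 (λ k x y → k :+ (x :* k :+ y :* k) := (con 1ℚ :+ x) :* k :+ y :* k) refl (K (suc a) b) (fromℤ (+ a)) (fromℤ (+ b))

euler-⊗ : ∀ f g → euler (f ⊗ g) ≈ₛ euler f ⊗ g ⊕ f ⊗ euler g
euler-⊗ f g n = begin
  fromℤ (+ n) * (f ⊗ g) n
    ≡⟨ cong (fromℤ (+ n) *_) (⊗-splitSum f g n) ⟩
  fromℤ (+ n) * splitSum (λ a b → f a * g b) n
    ≡⟨ splitSum-leibniz _ n ⟩
  splitSum (λ a b → fromℤ (+ a) * (f a * g b) + fromℤ (+ b) * (f a * g b)) n
    ≡⟨ splitSum-cong (λ a b → cong₂ _+_ (sym (ℚP.*-assoc (fromℤ (+ a)) (f a) (g b)))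
         (solve 3 (λ x y z → x :* (y :* z) := y :* (x :* z)) refl (fromℤ (+ b)) (f a) (g b))) n ⟩
  splitSum (λ a b → euler f a * g b + f a * euler g b) n
    ≡⟨ splitSum-+ _ _ n ⟩
  splitSum (λ a b → euler f a * g b) n + splitSum (λ a b → f a * euler g b) n
    ≡⟨ cong₂ _+_ (⊗-splitSum (euler f) g n) (⊗-splitSum f (euler g) n) ⟨
  (euler f ⊗ g ⊕ f ⊗ euler g) n ∎
  where
  open ≡-Reasoning
  open ℚ-Solver.+-*-Solver

euler-X² : euler (X^ 2) ≈ₛ nat 2 ⊗ X^ 2
euler-X² n = trans (coeff n) (sym (cst-⊗ (fromℤ (+ 2)) (X^ 2) n))
  where
  coeff : ∀ n → fromℤ (+ n) * X^ 2 n ≡ fromℤ (+ 2) * X^ 2 n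
  coeff zero                = refl
  coeff (suc zero)          = trans (ℚP.*-zeroʳ (fromℤ (+ 1))) (sym (ℚP.*-zeroʳ (fromℤ (+ 2))))
  coeff (suc (suc zero))    = refl
  coeff (suc (suc (suc n))) = trans (ℚP.*-zeroʳ (fromℤ (+ suc (suc (suc n))))) (sym (ℚP.*-zeroʳ (fromℤ (+ 2))))

weighted-suc : ∀ β f → weighted (suc β) f ≈ₛ euler (weighted β f) ⊕ weighted β f
weighted-suc β f n = begin
  fromℤ (+ suc n) * weighted β f n                        ≡⟨ cong (_* weighted β f n) (fromℤ-suc n) ⟩
  (1ℚ + fromℤ (+ n)) * weighted β f n                     ≡⟨ ℚP.*-distribʳ-+ (weighted β f n) 1ℚ (fromℤ (+ n)) ⟩
  1ℚ * weighted β f n + fromℤ (+ n) * weighted β f n      ≡⟨ trans (cong (_+ fromℤ (+ n) * weighted β f n) (ℚP.*-identityˡ (weighted β f n))) (ℚP.+-comm (weighted β f n) _) ⟩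
  fromℤ (+ n) * weighted β f n + weighted β f n           ∎
  where open ≡-Reasoning

X⁴≈X²⊗X² : X^ 4 ≈ₛ X^ 2 ⊗ X^ 2
X⁴≈X²⊗X² zero          = refl
X⁴≈X²⊗X² (suc zero)    = refl
X⁴≈X²⊗X² (suc (suc m)) = trans (coeff m) (sym (X²⊗-coeff (X^ 2) m))
  where
  coeff : ∀ m → X^ 4 (suc (suc m)) ≡ X^ 2 m
  coeff zero                = refl
  coeff (suc zero)          = refl
  coeff (suc (suc zero))    = refl
  coeff (suc (suc (suc m))) = refl

*-cancelˡ-zero : ∀ c x → c ≢ 0ℚ → c * x ≡ 0ℚ → x ≡ 0ℚ
*-cancelˡ-zero c x c≢0 e = begin
  x                 ≡⟨ ℚP.*-identityˡ x ⟨
  1ℚ * x            ≡⟨ cong (_* x) (ℚP.*-inverseˡ c) ⟨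
  (1/ c * c) * x    ≡⟨ ℚP.*-assoc (1/ c) c x ⟩
  1/ c * (c * x)    ≡⟨ cong (1/ c *_) e ⟩
  1/ c * 0ℚ         ≡⟨ ℚP.*-zeroʳ (1/ c) ⟩
  0ℚ ∎
  where
  open ≡-Reasoning
  instance _ = ℚ.≢-nonZero c≢0

⊗-zero-divisor : ∀ f g → f 0 ≢ 0ℚ → f ⊗ g ≈ₛ 0ₛ → g ≈ₛ 0ₛ
⊗-zero-divisor f g f0≢0 fg≈0 n = trans (vanish n n ℕP.≤-refl) (sym (0ₛ-coeff n))
  where
  open ≡-Reasoning
  vanish : ∀ n k → k ℕ.≤ n → g k ≡ 0ℚ
  vanish zero .zero ℕ.z≤n = *-cancelˡ-zero (f 0) (g 0) f0≢0 (fg≈0 0)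
  vanish (suc n) k k≤ with ℕP.m≤n⇒m<n∨m≡n k≤
  ... | inj₁ (ℕ.s≤s k≤n) = vanish n k k≤n
  ... | inj₂ refl = *-cancelˡ-zero (f 0) (g (suc n)) f0≢0 (begin
    f 0 * g (suc n)                                          ≡⟨ ℚP.+-identityʳ _ ⟨
    f 0 * g (suc n) + 0ℚ                                     ≡⟨ cong (_+_ (f 0 * g (suc n))) (splitSum-vanish n (λ a b b≤n →
                                                                  trans (cong (f (suc a) *_) (vanish n b b≤n)) (ℚP.*-zeroʳ (f (suc a))))) ⟨
    f 0 * g (suc n) + splitSum (λ a b → f (suc a) * g b) n   ≡⟨ ⊗-splitSum f g (suc n) ⟨
    (f ⊗ g) (suc n)                                          ≡⟨ fg≈0 (suc n) ⟩
    0ℚ ∎)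

-- Series that are rational functions of s

open CommutativeRing FPS-commutativeRing using (distribˡ; distribʳ; zeroˡ; *-identityˡ; *-identityʳ; +-identityˡ; -‿inverseʳ; *-assoc; *-comm)
open Algebra.Properties.Semiring.Exp (CommutativeRing.semiring FPS-commutativeRing) using (^-homo-*)
open Algebra.Properties.Ring (CommutativeRing.ring FPS-commutativeRing) using (-‿distribˡ-*; -‿distribʳ-*)
open FPS-Solver using (Polynomial; op; [+]; [*]; con; var; _:^_; :-_; _:+_; _:*_; _:-_; _:=_; solve; normalise; correct; ⟦_⟧N)
  renaming (⟦_⟧ to eval⟦_⟧)

leibniz-chain : ∀ {f g f′ g′ N} → euler f ≈ₛ f′ ⊗ N → euler g ≈ₛ g′ ⊗ N → euler (f ⊗ g) ≈ₛ (f′ ⊗ g ⊕ f ⊗ g′) ⊗ N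
leibniz-chain {f} {g} {f′} {g′} {N} ef eg = begin
  euler (f ⊗ g)
    ≈⟨ euler-⊗ f g ⟩
  euler f ⊗ g ⊕ f ⊗ euler g
    ≈⟨ ⊕-cong (⊗-cong ef ≈ₛ-refl) (⊗-cong (≈ₛ-refl {f}) eg) ⟩
  f′ ⊗ N ⊗ g ⊕ f ⊗ (g′ ⊗ N)
    ≈⟨ solve 5 (λ f g f′ g′ N → f′ :* N :* g :+ f :* (g′ :* N) := (f′ :* g :+ f :* g′) :* N) (λ _ → refl) f g f′ g′ N ⟩
  (f′ ⊗ g ⊕ f ⊗ g′) ⊗ N ∎
  where open ≈ₛ-Reasoning

⊗-cancelˡ : ∀ f {g h} → f 0 ≢ 0ℚ → f ⊗ g ≈ₛ f ⊗ h → g ≈ₛ h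
⊗-cancelˡ f {g} {h} f0≢0 fg≈fh = begin
  g                  ≈⟨ solve 2 (λ g h → g := (g :- h) :+ h) (λ _ → refl) g h ⟩
  (g ⊖ h) ⊕ h        ≈⟨ ⊕-cong (⊗-zero-divisor f (g ⊖ h) f0≢0 f[g-h]≈0) ≈ₛ-refl ⟩
  0ₛ ⊕ h             ≈⟨ +-identityˡ h ⟩
  h                  ∎
  where
  open ≈ₛ-Reasoning
  f[g-h]≈0 : f ⊗ (g ⊖ h) ≈ₛ 0ₛ
  f[g-h]≈0 = begin
    f ⊗ (g ⊖ h)        ≈⟨ solve 3 (λ f g h → f :* (g :- h) := f :* g :- f :* h) (λ _ → refl) f g h ⟩
    f ⊗ g ⊖ f ⊗ h      ≈⟨ ⊕-cong fg≈fh ≈ₛ-refl ⟩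
    f ⊗ h ⊖ f ⊗ h      ≈⟨ -‿inverseʳ (f ⊗ h) ⟩
    0ₛ ∎

square-root-unique : ∀ f g → f ⊗ f ≈ₛ g ⊗ g → f 0 ≡ 1ℚ → g 0 ≡ 1ℚ → f ≈ₛ g
square-root-unique f g ff≈gg f0 g0 = begin
  f                  ≈⟨ solve 2 (λ f g → f := (f :- g) :+ g) (λ _ → refl) f g ⟩
  (f ⊖ g) ⊕ g        ≈⟨ ⊕-cong (⊗-zero-divisor (f ⊕ g) (f ⊖ g) f0+g0≢0 [f+g][f-g]≈0) ≈ₛ-refl ⟩
  0ₛ ⊕ g             ≈⟨ +-identityˡ g ⟩
  g                  ∎
  where
  open ≈ₛ-Reasoning
  f0+g0≢0 : f 0 + g 0 ≢ 0ℚ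
  f0+g0≢0 rewrite f0 | g0 = λ ()
  [f+g][f-g]≈0 : (f ⊕ g) ⊗ (f ⊖ g) ≈ₛ 0ₛ
  [f+g][f-g]≈0 = begin
    (f ⊕ g) ⊗ (f ⊖ g)   ≈⟨ solve 2 (λ f g → (f :+ g) :* (f :- g) := f :* f :- g :* g) (λ _ → refl) f g ⟩
    f ⊗ f ⊖ g ⊗ g       ≈⟨ ⊕-cong ff≈gg ≈ₛ-refl ⟩
    g ⊗ g ⊖ g ⊗ g       ≈⟨ -‿inverseʳ (g ⊗ g) ⟩
    0ₛ ∎

Ex : Set
Ex = Polynomial 1

S : Ex
S = var zero

∂ : Ex → Ex
∂ (op [+] p q) = ∂ p :+ ∂ q
∂ (op [*] p q) = ∂ p :* q :+ p :* ∂ q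
∂ (con c)      = con (+ 0)
∂ (var x)      = con (+ 1)
∂ (p :^ k)     = ∂^ p (∂ p) k
  where
  ∂^ : Ex → Ex → ℕ → Ex
  ∂^ p ∂p zero    = con (+ 0)
  ∂^ p ∂p (suc k) = ∂p :* p :^ k :+ p :* ∂^ p ∂p k
∂ (:- p)       = :- ∂ p

atOne : Ex → ℚ
atOne (op [+] p q) = atOne p + atOne q
atOne (op [*] p q) = atOne p * atOne q
atOne (con c)      = fromℤ c
atOne (var x)      = 1ℚ
atOne (p :^ k)     = atOne p ^ k
atOne (:- p)       = - atOne p

infix 8 _·S^_·[1+S]^_
data Denominator : Set where
  _·S^_·[1+S]^_ : ℕ → ℕ → ℕ → Denominator

denom : Denominator → Ex
denom (c ·S^ a ·[1+S]^ b) = con (+ c) :* S :^ a :* (con (+ 1) :+ S) :^ b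

infixl 6 _·ᵈ_
_·ᵈ_ : Denominator → Denominator → Denominator
(c ·S^ a ·[1+S]^ b) ·ᵈ (c′ ·S^ a′ ·[1+S]^ b′) = (c ℕ.* c′) ·S^ a ℕ.+ a′ ·[1+S]^ (b ℕ.+ b′)

S·ᵈ_ : Denominator → Denominator
S·ᵈ (c ·S^ a ·[1+S]^ b) = c ·S^ suc a ·[1+S]^ b

_^ᵈ_ : Denominator → ℕ → Denominator
d ^ᵈ zero  = 1 ·S^ 0 ·[1+S]^ 0
d ^ᵈ suc k = d ·ᵈ d ^ᵈ k

commonDenom : Denominator → Denominator → Denominator
commonDenom (c ·S^ a ·[1+S]^ b) (c′ ·S^ a′ ·[1+S]^ b′) = (c ℕ.* c′) ·S^ a ℕ.⊔ a′ ·[1+S]^ (b ℕ.⊔ b′)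

cofactorˡ cofactorʳ : Denominator → Denominator → Denominator
cofactorˡ (c ·S^ a ·[1+S]^ b) (c′ ·S^ a′ ·[1+S]^ b′) = c′ ·S^ a ℕ.⊔ a′ ℕ.∸ a ·[1+S]^ (b ℕ.⊔ b′ ℕ.∸ b)
cofactorʳ (c ·S^ a ·[1+S]^ b) (c′ ·S^ a′ ·[1+S]^ b′) = c ·S^ a ℕ.⊔ a′ ℕ.∸ a′ ·[1+S]^ (b ℕ.⊔ b′ ℕ.∸ b′)

cofactorˡ-·ᵈ : ∀ d d′ → cofactorˡ d d′ ·ᵈ d ≡ commonDenom d d′
cofactorˡ-·ᵈ (c ·S^ a ·[1+S]^ b) (c′ ·S^ a′ ·[1+S]^ b′)
  rewrite ℕP.*-comm c′ c | ℕP.m∸n+n≡m (ℕP.m≤m⊔n a a′) | ℕP.m∸n+n≡m (ℕP.m≤m⊔n b b′) = refl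

cofactorʳ-·ᵈ : ∀ d d′ → cofactorʳ d d′ ·ᵈ d′ ≡ commonDenom d d′
cofactorʳ-·ᵈ (c ·S^ a ·[1+S]^ b) (c′ ·S^ a′ ·[1+S]^ b′)
  rewrite ℕP.m∸n+n≡m (ℕP.m≤n⊔m a a′) | ℕP.m∸n+n≡m (ℕP.m≤n⊔m b b′) = refl

module RationalFunctionsOf (s : FPS) (s0 : s 0 ≡ 1ℚ) (s² : s ⊗ s ≈ₛ nat 1 ⊖ nat 4 ⊗ X^ 2) where

  ⟦_⟧ : Ex → FPS
  ⟦ e ⟧ = eval⟦ e ⟧ (s ∷ [])

  euler-⟦⟧ : ∀ e → euler ⟦ e ⟧ ≈ₛ ⟦ ∂ e ⟧ ⊗ euler s
  euler-⟦⟧ (op [+] p q) = ≈ₛ-trans (euler-⊕ ⟦ p ⟧ ⟦ q ⟧)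
                            (≈ₛ-trans (⊕-cong (euler-⟦⟧ p) (euler-⟦⟧ q)) (≈ₛ-sym (distribʳ (euler s) ⟦ ∂ p ⟧ ⟦ ∂ q ⟧)))
  euler-⟦⟧ (op [*] p q) = leibniz-chain (euler-⟦⟧ p) (euler-⟦⟧ q)
  euler-⟦⟧ (con c)      = ≈ₛ-trans (euler-cst (fromℤ c)) (≈ₛ-sym (zeroˡ (euler s)))
  euler-⟦⟧ (var zero)   = ≈ₛ-sym (*-identityˡ (euler s))
  euler-⟦⟧ (p :^ k)     = pow k
    where
    pow : ∀ k → euler ⟦ p :^ k ⟧ ≈ₛ ⟦ ∂ (p :^ k) ⟧ ⊗ euler s
    pow zero    = ≈ₛ-trans (euler-cst 1ℚ) (≈ₛ-sym (zeroˡ (euler s)))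
    pow (suc k) = leibniz-chain (euler-⟦⟧ p) (pow k)
  euler-⟦⟧ (:- p)       = ≈ₛ-trans (euler-⊝ ⟦ p ⟧)
                            (≈ₛ-trans (⊝-cong (euler-⟦⟧ p)) (-‿distribˡ-* ⟦ ∂ p ⟧ (euler s)))

  ⟦⟧-atOne : ∀ e → ⟦ e ⟧ 0 ≡ atOne e
  ⟦⟧-atOne (op [+] p q) = cong₂ _+_ (⟦⟧-atOne p) (⟦⟧-atOne q)
  ⟦⟧-atOne (op [*] p q) = cong₂ _*_ (⟦⟧-atOne p) (⟦⟧-atOne q)
  ⟦⟧-atOne (con c)      = refl
  ⟦⟧-atOne (var zero)   = s0
  ⟦⟧-atOne (p :^ k)     = pow k
    where
    pow : ∀ k → ⟦ p :^ k ⟧ 0 ≡ atOne p ^ k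
    pow zero    = refl
    pow (suc k) = cong₂ _*_ (⟦⟧-atOne p) (pow k)
  ⟦⟧-atOne (:- p)       = cong -_ (⟦⟧-atOne p)

  normalise-≈ : ∀ p q → normalise p ≡ normalise q → ⟦ p ⟧ ≈ₛ ⟦ q ⟧
  normalise-≈ p q eq = ≈ₛ-trans (≈ₛ-sym (correct p (s ∷ []))) (≈ₛ-trans (λ n → cong (λ nf → ⟦ nf ⟧N (s ∷ []) n) eq) (correct q (s ∷ [])))

  s⊗euler-s : s ⊗ euler s ≈ₛ s ⊗ s ⊖ nat 1
  s⊗euler-s = ⊗-cancelˡ (nat 2) (λ ()) (begin
    nat 2 ⊗ (s ⊗ euler s)
      ≈⟨ solve 2 (λ s N → con (+ 2) :* (s :* N) := N :* s :+ s :* N) (λ _ → refl) s (euler s) ⟩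
    euler s ⊗ s ⊕ s ⊗ euler s
      ≈⟨ euler-⊗ s s ⟨
    euler (s ⊗ s)
      ≈⟨ euler-cong s² ⟩
    euler (nat 1 ⊖ nat 4 ⊗ X^ 2)
      ≈⟨ ≈ₛ-trans (euler-⊕ _ _) (⊕-cong (euler-cst _) (euler-⊝ _)) ⟩
    0ₛ ⊖ euler (nat 4 ⊗ X^ 2)
      ≈⟨ ⊕-cong (≈ₛ-refl {0ₛ}) (⊝-cong (≈ₛ-trans (euler-⊗ (nat 4) (X^ 2)) (⊕-cong (⊗-cong (euler-cst _) ≈ₛ-refl) (⊗-cong ≈ₛ-refl euler-X²)))) ⟩
    0ₛ ⊖ (0ₛ ⊗ X^ 2 ⊕ nat 4 ⊗ (nat 2 ⊗ X^ 2))
      ≈⟨ solve 1 (λ y → con (+ 0) :- (con (+ 0) :* y :+ con (+ 4) :* (con (+ 2) :* y))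
                     := con (+ 2) :* ((con (+ 1) :- con (+ 4) :* y) :- con (+ 1))) (λ _ → refl) (X^ 2) ⟩
    nat 2 ⊗ ((nat 1 ⊖ nat 4 ⊗ X^ 2) ⊖ nat 1)
      ≈⟨ ⊗-cong ≈ₛ-refl (⊕-cong (≈ₛ-sym s²) ≈ₛ-refl) ⟩
    nat 2 ⊗ (s ⊗ s ⊖ nat 1) ∎)
    where open ≈ₛ-Reasoning

  ⟦denom-·ᵈ⟧ : ∀ d d′ → ⟦ denom (d ·ᵈ d′) ⟧ ≈ₛ ⟦ denom d ⟧ ⊗ ⟦ denom d′ ⟧
  ⟦denom-·ᵈ⟧ (c ·S^ a ·[1+S]^ b) (c′ ·S^ a′ ·[1+S]^ b′) = begin
    ⟦ con (+ (c ℕ.* c′)) ⟧ ⊗ ⟦ S :^ (a ℕ.+ a′) ⟧ ⊗ ⟦ 1+S :^ (b ℕ.+ b′) ⟧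
      ≈⟨ ⊗-cong (⊗-cong (λ { zero → trans (cong fromℤ (ℤP.pos-* c c′)) (fromℤ-* (+ c) (+ c′)) ; (suc n) → sym (c⊗c′-vanishes n) })
                        (^-homo-* s a a′)) (^-homo-* ⟦ 1+S ⟧ b b′) ⟩
    nat c ⊗ nat c′ ⊗ (⟦ S :^ a ⟧ ⊗ ⟦ S :^ a′ ⟧) ⊗ (⟦ 1+S :^ b ⟧ ⊗ ⟦ 1+S :^ b′ ⟧)
      ≈⟨ solve 6 (λ c c′ A A′ B B′ → c :* c′ :* (A :* A′) :* (B :* B′) := c :* A :* B :* (c′ :* A′ :* B′)) (λ _ → refl)
                 (nat c) (nat c′) ⟦ S :^ a ⟧ ⟦ S :^ a′ ⟧ ⟦ 1+S :^ b ⟧ ⟦ 1+S :^ b′ ⟧ ⟩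
    ⟦ denom (c ·S^ a ·[1+S]^ b) ⟧ ⊗ ⟦ denom (c′ ·S^ a′ ·[1+S]^ b′) ⟧ ∎
    where
    open ≈ₛ-Reasoning
    1+S : Ex
    1+S = con (+ 1) :+ S
    c⊗c′-vanishes : ∀ n → (nat c ⊗ nat c′) (suc n) ≡ 0ℚ
    c⊗c′-vanishes n = trans (cst-⊗ (fromℤ (+ c)) (nat c′) (suc n)) (ℚP.*-zeroʳ (fromℤ (+ c)))

  ⟦denom-S·ᵈ⟧ : ∀ d → ⟦ denom (S·ᵈ d) ⟧ ≈ₛ s ⊗ ⟦ denom d ⟧
  ⟦denom-S·ᵈ⟧ (c ·S^ a ·[1+S]^ b) =
    solve 4 (λ c s A B → c :* (s :* A) :* B := s :* (c :* A :* B)) (λ _ → refl) (nat c) s ⟦ S :^ a ⟧ ⟦ (con (+ 1) :+ S) :^ b ⟧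

  ⟦denom⟧-cofactors : ∀ {d d′} {X Y : FPS} → ⟦ denom (commonDenom d d′) ⟧ ⊗ (X ⊕ Y)
    ≈ₛ ⟦ denom (cofactorˡ d d′) ⟧ ⊗ (⟦ denom d ⟧ ⊗ X) ⊕ ⟦ denom (cofactorʳ d d′) ⟧ ⊗ (⟦ denom d′ ⟧ ⊗ Y)
  ⟦denom⟧-cofactors {d} {d′} {X} {Y} = begin
    L ⊗ (X ⊕ Y)                     ≈⟨ distribˡ L X Y ⟩
    L ⊗ X ⊕ L ⊗ Y                   ≈⟨ ⊕-cong (⊗-cong (lcmˡ) (≈ₛ-refl {X})) (⊗-cong lcmʳ (≈ₛ-refl {Y})) ⟩
    Wˡ ⊗ V ⊗ X ⊕ Wʳ ⊗ V′ ⊗ Y        ≈⟨ ⊕-cong (*-assoc Wˡ V X) (*-assoc Wʳ V′ Y) ⟩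
    Wˡ ⊗ (V ⊗ X) ⊕ Wʳ ⊗ (V′ ⊗ Y) ∎
    where
    open ≈ₛ-Reasoning
    L V V′ Wˡ Wʳ : FPS
    L  = ⟦ denom (commonDenom d d′) ⟧
    V  = ⟦ denom d ⟧
    V′ = ⟦ denom d′ ⟧
    Wˡ = ⟦ denom (cofactorˡ d d′) ⟧
    Wʳ = ⟦ denom (cofactorʳ d d′) ⟧
    lcmˡ : L ≈ₛ Wˡ ⊗ V
    lcmˡ = ≈ₛ-trans (λ n → cong (λ e → ⟦ denom e ⟧ n) (sym (cofactorˡ-·ᵈ d d′))) (⟦denom-·ᵈ⟧ (cofactorˡ d d′) d)
    lcmʳ : L ≈ₛ Wʳ ⊗ V′
    lcmʳ = ≈ₛ-trans (λ n → cong (λ e → ⟦ denom e ⟧ n) (sym (cofactorʳ-·ᵈ d d′))) (⟦denom-·ᵈ⟧ (cofactorʳ d d′) d′)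

  -- X ≐ p ∕ d : X is the rational function p(s) / d(s)
  infix 4 _≐_∕_
  record _≐_∕_ (X : FPS) (p : Ex) (d : Denominator) : Set where
    constructor cleared
    field denom⊗X≈num : ⟦ denom d ⟧ ⊗ X ≈ₛ ⟦ p ⟧
  open _≐_∕_

  ≐-cong : ∀ {X Y p d} → X ≈ₛ Y → X ≐ p ∕ d → Y ≐ p ∕ d
  ≐-cong X≈Y (cleared e) = cleared (≈ₛ-trans (⊗-cong ≈ₛ-refl (≈ₛ-sym X≈Y)) e)

  ≐-S : s ≐ S ∕ 1 ·S^ 0 ·[1+S]^ 0
  ≐-S = cleared (solve 1 (λ s → con (+ 1) :* con (+ 1) :* con (+ 1) :* s := s) (λ _ → refl) s)

  ≐-con : ∀ c → cst (fromℤ c) ≐ con c ∕ 1 ·S^ 0 ·[1+S]^ 0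
  ≐-con c = cleared (solve 1 (λ x → con (+ 1) :* con (+ 1) :* con (+ 1) :* x := x) (λ _ → refl) (cst (fromℤ c)))

  ≐-+ : ∀ {X Y p q d d′} → X ≐ p ∕ d → Y ≐ q ∕ d′ →
    X ⊕ Y ≐ p :* denom (cofactorˡ d d′) :+ q :* denom (cofactorʳ d d′) ∕ commonDenom d d′
  ≐-+ {X} {Y} {p} {q} {d} {d′} (cleared dX≈p) (cleared d′Y≈q) = cleared (begin
    ⟦ denom (commonDenom d d′) ⟧ ⊗ (X ⊕ Y)
      ≈⟨ ⟦denom⟧-cofactors {d} {d′} ⟩
    Wˡ ⊗ (⟦ denom d ⟧ ⊗ X) ⊕ Wʳ ⊗ (⟦ denom d′ ⟧ ⊗ Y)
      ≈⟨ ⊕-cong (⊗-cong (≈ₛ-refl {Wˡ}) dX≈p) (⊗-cong (≈ₛ-refl {Wʳ}) d′Y≈q) ⟩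
    Wˡ ⊗ ⟦ p ⟧ ⊕ Wʳ ⊗ ⟦ q ⟧
      ≈⟨ ⊕-cong (*-comm Wˡ ⟦ p ⟧) (*-comm Wʳ ⟦ q ⟧) ⟩
    ⟦ p ⟧ ⊗ Wˡ ⊕ ⟦ q ⟧ ⊗ Wʳ ∎)
    where
    open ≈ₛ-Reasoning
    Wˡ Wʳ : FPS
    Wˡ = ⟦ denom (cofactorˡ d d′) ⟧
    Wʳ = ⟦ denom (cofactorʳ d d′) ⟧

  ≐-* : ∀ {X Y p q d d′} → X ≐ p ∕ d → Y ≐ q ∕ d′ → X ⊗ Y ≐ p :* q ∕ d ·ᵈ d′
  ≐-* {X} {Y} {p} {q} {d} {d′} (cleared dX≈p) (cleared d′Y≈q) = cleared (begin
    ⟦ denom (d ·ᵈ d′) ⟧ ⊗ (X ⊗ Y)             ≈⟨ ⊗-cong (⟦denom-·ᵈ⟧ d d′) (≈ₛ-refl {X ⊗ Y}) ⟩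
    ⟦ denom d ⟧ ⊗ ⟦ denom d′ ⟧ ⊗ (X ⊗ Y)
      ≈⟨ solve 4 (λ u v X Y → u :* v :* (X :* Y) := u :* X :* (v :* Y)) (λ _ → refl) ⟦ denom d ⟧ ⟦ denom d′ ⟧ X Y ⟩
    ⟦ denom d ⟧ ⊗ X ⊗ (⟦ denom d′ ⟧ ⊗ Y)      ≈⟨ ⊗-cong dX≈p d′Y≈q ⟩
    ⟦ p ⟧ ⊗ ⟦ q ⟧ ∎)
    where open ≈ₛ-Reasoning

  ≐-⊝ : ∀ {X p d} → X ≐ p ∕ d → ⊝ X ≐ :- p ∕ d
  ≐-⊝ {X} {p} {d} (cleared dX≈p) = cleared (≈ₛ-trans (≈ₛ-sym (-‿distribʳ-* ⟦ denom d ⟧ X)) (⊝-cong dX≈p))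

  ≐-⊖ : ∀ {X Y p q d d′} → X ≐ p ∕ d → Y ≐ q ∕ d′ →
    X ⊖ Y ≐ p :* denom (cofactorˡ d d′) :+ :- q :* denom (cofactorʳ d d′) ∕ commonDenom d d′
  ≐-⊖ X≐ Y≐ = ≐-+ X≐ (≐-⊝ Y≐)

  ≐-^ : ∀ {X p d} k → X ≐ p ∕ d → X ^ₛ k ≐ p :^ k ∕ d ^ᵈ k
  ≐-^ zero    X≐ = cleared (denom⊗X≈num (≐-con (+ 1)))
  ≐-^ (suc k) X≐ = cleared (denom⊗X≈num (≐-* X≐ (≐-^ k X≐)))

  ≐-X² : X^ 2 ≐ con (+ 1) :- S :* S ∕ 4 ·S^ 0 ·[1+S]^ 0
  ≐-X² = cleared (begin
    nat 4 ⊗ nat 1 ⊗ nat 1 ⊗ X^ 2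
      ≈⟨ solve 1 (λ y → con (+ 4) :* con (+ 1) :* con (+ 1) :* y := con (+ 1) :- (con (+ 1) :- con (+ 4) :* y)) (λ _ → refl) (X^ 2) ⟩
    nat 1 ⊖ (nat 1 ⊖ nat 4 ⊗ X^ 2)     ≈⟨ ⊕-cong (≈ₛ-refl {nat 1}) (⊝-cong (≈ₛ-sym s²)) ⟩
    nat 1 ⊖ s ⊗ s ∎)
    where open ≈ₛ-Reasoning

  ≐-X⁴ : X^ 4 ≐ (con (+ 1) :- S :* S) :* (con (+ 1) :- S :* S) ∕ 16 ·S^ 0 ·[1+S]^ 0
  ≐-X⁴ = ≐-cong (≈ₛ-sym X⁴≈X²⊗X²) (≐-* ≐-X² ≐-X²)

  ≐-divideS : ∀ {X Y p d} → s ⊗ X ≈ₛ Y → Y ≐ p ∕ d → X ≐ p ∕ S·ᵈ d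
  ≐-divideS {X} {Y} {p} {d} sX≈Y (cleared dY≈p) = cleared (begin
    ⟦ denom (S·ᵈ d) ⟧ ⊗ X      ≈⟨ ⊗-cong (⟦denom-S·ᵈ⟧ d) (≈ₛ-refl {X}) ⟩
    s ⊗ V ⊗ X                  ≈⟨ solve 3 (λ s V X → s :* V :* X := V :* (s :* X)) (λ _ → refl) s V X ⟩
    V ⊗ (s ⊗ X)                ≈⟨ ⊗-cong (≈ₛ-refl {V}) sX≈Y ⟩
    V ⊗ Y                      ≈⟨ dY≈p ⟩
    ⟦ p ⟧ ∎)
    where
    open ≈ₛ-Reasoning
    V : FPS
    V = ⟦ denom d ⟧

  -- the quotient rule, with s · euler s = s² - 1
  ≐-weighted-suc : ∀ β f {p d} → weighted β f ≐ p ∕ d →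
    weighted (suc β) f ≐ (S :* S :- con (+ 1)) :* (denom d :* ∂ p :- ∂ (denom d) :* p) :+ S :* denom d :* p ∕ S·ᵈ (d ·ᵈ d)
  ≐-weighted-suc β f {p} {d} (cleared AX≈B) = cleared (begin
    ⟦ denom (S·ᵈ (d ·ᵈ d)) ⟧ ⊗ weighted (suc β) f
      ≈⟨ ⊗-cong (≈ₛ-trans (⟦denom-S·ᵈ⟧ (d ·ᵈ d)) (⊗-cong (≈ₛ-refl {s}) (⟦denom-·ᵈ⟧ d d))) (weighted-suc β f) ⟩
    s ⊗ (A ⊗ A) ⊗ (E ⊕ X)
      ≈⟨ solve 4 (λ s A E X → s :* (A :* A) :* (E :+ X) := s :* A :* (A :* E) :+ s :* A :* (A :* X)) (λ _ → refl) s A E X ⟩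
    s ⊗ A ⊗ (A ⊗ E) ⊕ s ⊗ A ⊗ (A ⊗ X)
      ≈⟨ ⊕-cong (⊗-cong (≈ₛ-refl {s ⊗ A}) A⊗E) (⊗-cong (≈ₛ-refl {s ⊗ A}) AX≈B) ⟩
    s ⊗ A ⊗ (B′ ⊗ N ⊖ A′ ⊗ N ⊗ X) ⊕ s ⊗ A ⊗ B
      ≈⟨ solve 7 (λ s A B B′ A′ N X → s :* A :* (B′ :* N :- A′ :* N :* X) :+ s :* A :* B
                                    := (s :* N) :* (A :* B′ :- A′ :* (A :* X)) :+ s :* A :* B) (λ _ → refl) s A B B′ A′ N X ⟩
    (s ⊗ N) ⊗ (A ⊗ B′ ⊖ A′ ⊗ (A ⊗ X)) ⊕ s ⊗ A ⊗ B
      ≈⟨ ⊕-cong (⊗-cong s⊗euler-s (⊕-cong (≈ₛ-refl {A ⊗ B′}) (⊝-cong (⊗-cong (≈ₛ-refl {A′}) AX≈B)))) (≈ₛ-refl {s ⊗ A ⊗ B}) ⟩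
    (s ⊗ s ⊖ nat 1) ⊗ (A ⊗ B′ ⊖ A′ ⊗ B) ⊕ s ⊗ A ⊗ B ∎)
    where
    open ≈ₛ-Reasoning
    X E A A′ B B′ N : FPS
    X = weighted β f
    E = euler X
    A = ⟦ denom d ⟧
    A′ = ⟦ ∂ (denom d) ⟧
    B = ⟦ p ⟧
    B′ = ⟦ ∂ p ⟧
    N = euler s
    A⊗E : A ⊗ E ≈ₛ B′ ⊗ N ⊖ A′ ⊗ N ⊗ X
    A⊗E = begin
      A ⊗ E                                ≈⟨ solve 2 (λ AE K → AE := (K :+ AE) :- K) (λ _ → refl) (A ⊗ E) (A′ ⊗ N ⊗ X) ⟩
      (A′ ⊗ N ⊗ X ⊕ A ⊗ E) ⊖ A′ ⊗ N ⊗ X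
        ≈⟨ ⊕-cong (⊕-cong (⊗-cong (euler-⟦⟧ (denom d)) (≈ₛ-refl {X})) (≈ₛ-refl {A ⊗ E})) (≈ₛ-refl {⊝ (A′ ⊗ N ⊗ X)}) ⟨
      (euler A ⊗ X ⊕ A ⊗ E) ⊖ A′ ⊗ N ⊗ X   ≈⟨ ⊕-cong (euler-⊗ A X) (≈ₛ-refl {⊝ (A′ ⊗ N ⊗ X)}) ⟨
      euler (A ⊗ X) ⊖ A′ ⊗ N ⊗ X           ≈⟨ ⊕-cong (≈ₛ-trans (euler-cong AX≈B) (euler-⟦⟧ p)) (≈ₛ-refl {⊝ (A′ ⊗ N ⊗ X)}) ⟩
      B′ ⊗ N ⊖ A′ ⊗ N ⊗ X ∎

  constantTerm≢0 : ∀ u → atOne u ≢ 0ℚ → ⟦ u ⟧ 0 ≢ 0ℚ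
  constantTerm≢0 u u1≢0 = subst (_≢ 0ℚ) (sym (⟦⟧-atOne u)) u1≢0

  ≐-reduce : ∀ {X p d} p′ d′ → X ≐ p ∕ d → atOne (denom d) ≢ 0ℚ →
    normalise (denom d :* p′) ≡ normalise (p :* denom d′) → X ≐ p′ ∕ d′
  ≐-reduce {X} {p} {d} p′ d′ (cleared AX≈B) d1≢0 cross = cleared (⊗-cancelˡ A (constantTerm≢0 (denom d) d1≢0) (begin
    A ⊗ (A′ ⊗ X)           ≈⟨ solve 3 (λ A A′ X → A :* (A′ :* X) := A′ :* (A :* X)) (λ _ → refl) A A′ X ⟩
    A′ ⊗ (A ⊗ X)           ≈⟨ ⊗-cong (≈ₛ-refl {A′}) AX≈B ⟩
    A′ ⊗ ⟦ p ⟧             ≈⟨ ⊗-comm A′ ⟦ p ⟧ ⟩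
    ⟦ p :* denom d′ ⟧      ≈⟨ normalise-≈ (denom d :* p′) (p :* denom d′) cross ⟨
    ⟦ denom d :* p′ ⟧ ∎))
    where
    open ≈ₛ-Reasoning
    A A′ : FPS
    A = ⟦ denom d ⟧
    A′ = ⟦ denom d′ ⟧

  ≐-unique : ∀ {X Y p q d d′} → X ≐ p ∕ d → Y ≐ q ∕ d′ → atOne (denom d) ≢ 0ℚ → atOne (denom d′) ≢ 0ℚ →
    normalise (denom d :* q) ≡ normalise (p :* denom d′) → X ≈ₛ Y
  ≐-unique {X} {Y} {p} {q} {d} {d′} X≐ (cleared d′Y≈q) d1≢0 d′1≢0 cross =
    ⊗-cancelˡ ⟦ denom d′ ⟧ (constantTerm≢0 (denom d′) d′1≢0) (≈ₛ-trans (denom⊗X≈num (≐-reduce q d′ X≐ d1≢0 cross)) (≈ₛ-sym d′Y≈q))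


-- Closed forms of the area moments

module AreaMoments (s : FPS) (s0 : s 0 ≡ 1ℚ) (s² : s ⊗ s ≈ₛ nat 1 ⊖ nat 4 ⊗ X^ 2) where
  open RationalFunctionsOf s s0 s²
  open ≈ₛ-Reasoning

  catalan-equation : moment 0 ≈ₛ nat 1 ⊕ X^ 2 ⊗ (moment 0 ⊗ moment 0)
  catalan-equation = begin
    moment 0
      ≈⟨ moment-recursion 0 (term (+ 1) 0 0 0 ∷ []) expand₀ ⟩
    nat 1 ⊕ X^ 2 ⊗ (nat 1 ⊗ (moment 0 ⊗ moment 0) ⊕ 0ₛ)
      ≈⟨ solve 2 (λ y C → con (+ 1) :+ y :* (con (+ 1) :* (C :* C) :+ con (+ 0)) := con (+ 1) :+ y :* (C :* C)) (λ _ → refl) (X^ 2) (moment 0) ⟩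
    nat 1 ⊕ X^ 2 ⊗ (moment 0 ⊗ moment 0) ∎

  catalan-residual : moment 0 ⊖ X^ 2 ⊗ (moment 0 ⊗ moment 0) ≈ₛ nat 1
  catalan-residual = begin
    moment 0 ⊖ X^ 2 ⊗ (moment 0 ⊗ moment 0)                            ≈⟨ ⊕-cong catalan-equation ≈ₛ-refl ⟩
    (nat 1 ⊕ X^ 2 ⊗ (moment 0 ⊗ moment 0)) ⊖ X^ 2 ⊗ (moment 0 ⊗ moment 0)
      ≈⟨ solve 2 (λ y C → (con (+ 1) :+ y :* (C :* C)) :- y :* (C :* C) := con (+ 1)) (λ _ → refl) (X^ 2) (moment 0) ⟩
    nat 1 ∎

  s≈1-2x²C : s ≈ₛ nat 1 ⊖ nat 2 ⊗ X^ 2 ⊗ moment 0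
  s≈1-2x²C = square-root-unique s _ (≈ₛ-trans s² (≈ₛ-sym square)) s0 refl
    where
    square : (nat 1 ⊖ nat 2 ⊗ X^ 2 ⊗ moment 0) ⊗ (nat 1 ⊖ nat 2 ⊗ X^ 2 ⊗ moment 0) ≈ₛ nat 1 ⊖ nat 4 ⊗ X^ 2
    square = begin
      (nat 1 ⊖ nat 2 ⊗ X^ 2 ⊗ moment 0) ⊗ (nat 1 ⊖ nat 2 ⊗ X^ 2 ⊗ moment 0)
        ≈⟨ solve 2 (λ y C → (con (+ 1) :- con (+ 2) :* y :* C) :* (con (+ 1) :- con (+ 2) :* y :* C)
                          := con (+ 1) :- con (+ 4) :* y :* (C :- y :* (C :* C))) (λ _ → refl) (X^ 2) (moment 0) ⟩
      nat 1 ⊖ nat 4 ⊗ X^ 2 ⊗ (moment 0 ⊖ X^ 2 ⊗ (moment 0 ⊗ moment 0))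
        ≈⟨ ⊕-cong (≈ₛ-refl {nat 1}) (⊝-cong (⊗-cong (≈ₛ-refl {nat 4 ⊗ X^ 2}) catalan-residual)) ⟩
      nat 1 ⊖ nat 4 ⊗ X^ 2 ⊗ nat 1
        ≈⟨ ⊕-cong (≈ₛ-refl {nat 1}) (⊝-cong (*-identityʳ (nat 4 ⊗ X^ 2))) ⟩
      nat 1 ⊖ nat 4 ⊗ X^ 2 ∎

  moment-suc-at0 : ∀ k → moment (suc k) 0 ≡ 0ℚ
  moment-suc-at0 k = trans (ℚP.+-identityʳ _) (ℚP.*-zeroˡ (areaℚ [] ^ k))

  -- the terms A^k and B^k of the recursion add up to 2 x² C Pₖ, and 1 - 2 x² C = s
  s⊗moment-suc : ∀ k ts → (∀ A L B → (A + L + B) ^ suc k ≡ evalTerms (pureTerms (suc k) ++ ts) A L B) →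
    s ⊗ moment (suc k) ≈ₛ X^ 2 ⊗ termSeries ts
  s⊗moment-suc k ts expand = begin
    s ⊗ P
      ≈⟨ ⊗-cong s≈1-2x²C (≈ₛ-refl {P}) ⟩
    (nat 1 ⊖ nat 2 ⊗ X^ 2 ⊗ C) ⊗ P
      ≈⟨ solve 3 (λ y C P → (con (+ 1) :- con (+ 2) :* y :* C) :* P := P :- con (+ 2) :* y :* C :* P) (λ _ → refl) (X^ 2) C P ⟩
    P ⊖ nat 2 ⊗ X^ 2 ⊗ C ⊗ P
      ≈⟨ ⊕-cong recursion (≈ₛ-refl {⊝ (nat 2 ⊗ X^ 2 ⊗ C ⊗ P)}) ⟩
    (0ₛ ⊕ X^ 2 ⊗ (nat 1 ⊗ (P ⊗ C) ⊕ (nat 1 ⊗ (C ⊗ P) ⊕ R))) ⊖ nat 2 ⊗ X^ 2 ⊗ C ⊗ P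
      ≈⟨ solve 4 (λ y C P R → (con (+ 0) :+ y :* (con (+ 1) :* (P :* C) :+ (con (+ 1) :* (C :* P) :+ R))) :- con (+ 2) :* y :* C :* P := y :* R) (λ _ → refl) (X^ 2) C P R ⟩
    X^ 2 ⊗ R ∎
    where
    P C R : FPS
    P = moment (suc k)
    C = moment 0
    R = termSeries ts
    recursion : P ≈ₛ 0ₛ ⊕ X^ 2 ⊗ (nat 1 ⊗ (P ⊗ C) ⊕ (nat 1 ⊗ (C ⊗ P) ⊕ R))
    recursion = ≈ₛ-trans (moment-recursion (suc k) (pureTerms (suc k) ++ ts) expand)
                         (⊕-cong {cst (moment (suc k) 0)} {0ₛ} (λ { zero → moment-suc-at0 k ; (suc n) → refl }) ≈ₛ-refl)

  P₀≐ : moment 0 ≐ con (+ 2) ∕ 1 ·S^ 0 ·[1+S]^ 1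
  P₀≐ = cleared (begin
    ⟦ denom (1 ·S^ 0 ·[1+S]^ 1) ⟧ ⊗ C
      ≈⟨ solve 2 (λ s C → con (+ 1) :* s :^ 0 :* (con (+ 1) :+ s) :^ 1 :* C := (con (+ 1) :+ s) :* C) (λ _ → refl) s C ⟩
    (nat 1 ⊕ s) ⊗ C
      ≈⟨ ⊗-cong (⊕-cong (≈ₛ-refl {nat 1}) s≈1-2x²C) (≈ₛ-refl {C}) ⟩
    (nat 1 ⊕ (nat 1 ⊖ nat 2 ⊗ X^ 2 ⊗ C)) ⊗ C
      ≈⟨ solve 2 (λ y C → (con (+ 1) :+ (con (+ 1) :- con (+ 2) :* y :* C)) :* C := con (+ 2) :* (C :- y :* (C :* C))) (λ _ → refl) (X^ 2) C ⟩
    nat 2 ⊗ (C ⊖ X^ 2 ⊗ (C ⊗ C))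
      ≈⟨ ⊗-cong (≈ₛ-refl {nat 2}) catalan-residual ⟩
    nat 2 ⊗ nat 1
      ≈⟨ *-identityʳ (nat 2) ⟩
    nat 2 ∎)
    where
    C : FPS
    C = moment 0

  -- Pₖ = moment k and M^β Pₖ = weighted β (moment k); numerals in S-polynomials are constants
  module ClosedForms where
    open import Agda.Builtin.FromNat using (Number; fromNat)
    import Data.Nat.Literals as ℕ-Literals
    instance
      ℕ-number : Number ℕ
      ℕ-number = ℕ-Literals.number
      Ex-number : Number Ex
      Ex-number = record { Constraint = λ _ → ⊤ ; fromNat = λ n → con (+ n) }

    ≐-term : ∀ c {X Y p q d d′} → X ≐ p ∕ d → Y ≐ q ∕ d′ →
      cst (fromℤ c) ⊗ (X ⊗ Y) ≐ con c :* (p :* q) ∕ 1 ·S^ 0 ·[1+S]^ 0 ·ᵈ (d ·ᵈ d′)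
    ≐-term c X≐ Y≐ = ≐-* (≐-con c) (≐-* X≐ Y≐)

    ≐-0 : 0ₛ ≐ 0 ∕ 1 ·S^ 0 ·[1+S]^ 0
    ≐-0 = ≐-con (+ 0)

    MP₀≐ : weighted 1 (moment 0) ≐ 2 ∕ 1 ·S^ 1 ·[1+S]^ 1
    MP₀≐ = ≐-reduce _ _ (≐-weighted-suc 0 (moment 0) P₀≐) (λ ()) refl

    M²P₀≐ : weighted 2 (moment 0) ≐ 2 :+ 2 :* S :- 2 :* S :^ 2 ∕ 1 ·S^ 3 ·[1+S]^ 1
    M²P₀≐ = ≐-reduce _ _ (≐-weighted-suc 1 (moment 0) MP₀≐) (λ ()) refl

    M³P₀≐ : weighted 3 (moment 0) ≐ 6 :+ 6 :* S :- 6 :* S :^ 2 :- 6 :* S :^ 3 :+ 2 :* S :^ 4 ∕ 1 ·S^ 5 ·[1+S]^ 1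
    M³P₀≐ = ≐-reduce _ _ (≐-weighted-suc 2 (moment 0) M²P₀≐) (λ ()) refl

    P₁≐ : moment 1 ≐ 1 :- S ∕ 1 ·S^ 2 ·[1+S]^ 1
    P₁≐ = ≐-reduce _ _ (≐-divideS (s⊗moment-suc 0 mixed₁ expand₁) (≐-* ≐-X²
            (≐-+ (≐-term (+ 1) MP₀≐ P₀≐) ≐-0))) (λ ()) refl

    MP₁≐ : weighted 1 (moment 1) ≐ 2 :- 3 :* S :^ 2 :+ S :^ 3 ∕ 1 ·S^ 4 ·[1+S]^ 1
    MP₁≐ = ≐-reduce _ _ (≐-weighted-suc 0 (moment 1) P₁≐) (λ ()) refl

    M²P₁≐ : weighted 2 (moment 1) ≐ 8 :+ 2 :* S :- 14 :* S :^ 2 :- 2 :* S :^ 3 :+ 7 :* S :^ 4 :- S :^ 5 ∕ 1 ·S^ 6 ·[1+S]^ 1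
    M²P₁≐ = ≐-reduce _ _ (≐-weighted-suc 1 (moment 1) MP₁≐) (λ ()) refl

    P₂≐ : moment 2 ≐ 5 :- 3 :* S :- 7 :* S :^ 2 :+ 5 :* S :^ 3 ∕ 2 ·S^ 5 ·[1+S]^ 1
    P₂≐ = ≐-reduce _ _ (≐-divideS (s⊗moment-suc 1 mixed₂ expand₂) (≐-* ≐-X²
            (≐-+ (≐-term (+ 1) M²P₀≐ P₀≐) (≐-+ (≐-term (+ 2) MP₁≐ P₀≐)
            (≐-+ (≐-term (+ 2) P₁≐ P₁≐) (≐-+ (≐-term (+ 2) MP₀≐ P₁≐) ≐-0)))))) (λ ()) refl

    MP₂≐ : weighted 1 (moment 2) ≐ 25 :- 7 :* S :- 49 :* S :^ 2 :+ 15 :* S :^ 3 :+ 26 :* S :^ 4 :- 10 :* S :^ 5 ∕ 2 ·S^ 7 ·[1+S]^ 1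
    MP₂≐ = ≐-reduce _ _ (≐-weighted-suc 0 (moment 2) P₂≐) (λ ()) refl

    P₃≐ : moment 3 ≐ 45 :- 30 :* S :- 90 :* S :^ 2 :+ 60 :* S :^ 3 :+ 48 :* S :^ 4 :- 33 :* S :^ 5 :- S :^ 6 :+ S :^ 7
                     ∕ 2 ·S^ 8 ·[1+S]^ 1
    P₃≐ = ≐-reduce _ _ (≐-divideS (s⊗moment-suc 2 mixed₃ expand₃) (≐-* ≐-X²
            (≐-+ (≐-term (+ 3) MP₀≐ P₂≐) (≐-+ (≐-term (+ 3) M²P₀≐ P₁≐) (≐-+ (≐-term (+ 1) M³P₀≐ P₀≐)
            (≐-+ (≐-term (+ 3) P₁≐ P₂≐) (≐-+ (≐-term (+ 6) MP₁≐ P₁≐) (≐-+ (≐-term (+ 3) M²P₁≐ P₀≐)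
            (≐-+ (≐-term (+ 3) P₂≐ P₁≐) (≐-+ (≐-term (+ 3) MP₂≐ P₀≐) ≐-0)))))))))) (λ ()) refl

    D₀≐ : DqAt1 0 ≐ 2 ∕ 1 ·S^ 0 ·[1+S]^ 1
    D₀≐ = ≐-cong (≈ₛ-sym DqAt1-moment₀) P₀≐

    D₁≐ : DqAt1 1 ≐ 1 :- S ∕ 1 ·S^ 2 ·[1+S]^ 1
    D₁≐ = ≐-cong (≈ₛ-sym DqAt1-moment₁) P₁≐

    D₃≐ : DqAt1 3 ≐ 45 :- 75 :* S :- 15 :* S :^ 2 :+ 60 :* S :^ 3 :- 3 :* S :^ 4 :- 9 :* S :^ 5 :- 3 :* S :^ 6 ∕ 2 ·S^ 8 ·[1+S]^ 0
    D₃≐ = ≐-reduce _ _ (≐-cong (≈ₛ-sym DqAt1-moment₃) (≐-+ (≐-+ P₃≐ (≐-* (≐-con -[1+ 2 ]) P₂≐)) (≐-* (≐-con (+ 2)) P₁≐))) (λ ()) refl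

mainTheorem5 : (s : FPS) → s 0 ≡ 1ℚ → s ⊗ s ≈ₛ nat 1 ⊖ nat 4 ⊗ X^ 2 →
    (nat 2 ⊗ X^ 2 ⊗ DqAt1 0 ≈ₛ nat 1 ⊖ s)
    × ((nat 4 ⊗ X^ 2 ⊖ nat 16 ⊗ X^ 4) ⊗ DqAt1 1 ≈ₛ (nat 1 ⊖ s) ⊗ (nat 1 ⊖ s))
    × ((nat 4 ⊗ X^ 2 ⊖ nat 1) ^ₛ 4 ⊗ DqAt1 3
        ≈ₛ (⊝ nat 6)
           ⊗ (nat 4 ⊗ X^ 4 ⊗ s ⊕ nat 16 ⊗ X^ 4 ⊖ nat 7 ⊗ X^ 2 ⊗ s ⊕ nat 7 ⊗ X^ 2 ⊖ s ⊕ nat 1)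
           ⊗ (⊝ nat 1 ⊕ s))
mainTheorem5 s s0 s² =
    ≐-unique (≐-* (≐-* (≐-con (+ 2)) ≐-X²) D₀≐) 1-s≐ (λ ()) (λ ()) refl
  , ≐-unique (≐-* (≐-⊖ (≐-* (≐-con (+ 4)) ≐-X²) (≐-* (≐-con (+ 16)) ≐-X⁴)) D₁≐) (≐-* 1-s≐ 1-s≐) (λ ()) (λ ()) refl
  , ≐-unique (≐-* (≐-^ 4 (≐-⊖ (≐-* (≐-con (+ 4)) ≐-X²) (≐-con (+ 1)))) D₃≐)
             (≐-* (≐-* (≐-⊝ (≐-con (+ 6)))
                       (≐-+ (≐-⊖ (≐-+ (≐-⊖ (≐-+ (≐-* (≐-* (≐-con (+ 4)) ≐-X⁴) ≐-S) (≐-* (≐-con (+ 16)) ≐-X⁴))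
                                              (≐-* (≐-* (≐-con (+ 7)) ≐-X²) ≐-S))
                                        (≐-* (≐-con (+ 7)) ≐-X²))
                                  ≐-S)
                            (≐-con (+ 1))))
                  (≐-+ (≐-⊝ (≐-con (+ 1))) ≐-S))
             (λ ()) (λ ()) refl
  where
  open RationalFunctionsOf s s0 s²
  open AreaMoments s s0 s²
  open ClosedForms
  1-s≐ : nat 1 ⊖ s ≐ con (+ 1) :- S ∕ 1 ·S^ 0 ·[1+S]^ 0
  1-s≐ = ≐-reduce _ _ (≐-⊖ (≐-con (+ 1)) ≐-S) (λ ()) refl
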